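{- Let $T$ be a threshold graph which is not complete, with vertex connectivity $\kappa$, clique number $d$ and $b$--vector $(b_1,\ldots,b_d)$. Then: (a) $b_1=b_2=\cdots=b_\kappa=1$; (b) $b_i-1=|\mathcal{C}_i(T)|$ for every $\kappa+1\le i\le d-1$, and $b_d=|\mathcal{C}_d(T)|$; (c) $b_i=d_i(T)$ for every $i=1,\ldots,d$; (d) $b_{\kappa+1}=W(T-Y)$ for a minimum vertex-cut $Y$ of $T$.
   Context: All graphs are finite and simple. A threshold graph is a graph obtainable from a one-vertex graph by repeatedly adding either an isolated vertex or a vertex adjacent to all existing vertices. A clique is a set of vertices inducing a complete subgraph; an $i$--clique is a clique with $i$ vertices. The clique number $d$ is the largest size of a clique. If $c_i$ is the number of $i$--cliques, the $b$--vector $(b_1,\ldots,b_d)$ is defined by $\sum_{i=1}^d b_i(x+1)^{i-1}=\sum_{i=1}^d c_ix^{i-1}$. A vertex-cut is a set of vertices whose removal disconnects the graph; the vertex connectivity $\kappa$ is the minimum cardinality of a vertex-cut. For $Y\subseteq V(G)$, $W(G-Y)$ denotes the number of connected components of $G-Y$. $\mathcal{C}_i(G)$ is the set of maximal (by inclusion) cliques of $G$ of size $i$. A clique $C$ dominates a clique $C'$ if $C\subseteq C'$; a dominating $i$--clique of $G$ is a set of $i$--cliques of $G$ such that every maximal clique of $G$ of order at least $i$ is dominated by one of them; $d_i(G)$ is the minimum cardinality of a dominating $i$--clique of $G$. -}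

module Defs where

open import Data.Bool using (Bool; true; false; _∧_; _∨_; not) renaming (_≟_ to _≟ᵇ_)
open import Data.Nat as ℕ using (ℕ; zero; suc; _≤_; _<_)
open import Data.Integer as ℤ using (ℤ; +_)
open import Data.Fin using (Fin; zero; suc; _≟_)
open import Data.Fin.Subset using (Subset; _∈_; _∉_; _⊆_; ∣_∣)
open import Data.Vec using (Vec; []; _∷_; lookup)
open import Data.List using (List; []; _∷_; _++_; map; filter; length; allFin)
open import Data.Bool.ListAction using (all; any)
open import Data.List.Membership.Propositional using () renaming (_∈_ to _∈ₗ_)
open import Data.List.Relation.Unary.Unique.Propositional using (Unique)
open import Data.Product using (Σ; ∃; _×_; _,_)
open import Function.Definitions using (Bijective; Surjective)
open import Relation.Binary.PropositionalEquality using (_≡_; _≢_)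
open import Relation.Nullary using (¬_; does)
open import Function using (_⇔_)

record Graph (n : ℕ) : Set where
  field
    adj   : Fin n → Fin n → Bool
    sym   : ∀ u v → adj u v ≡ adj v u
    irref : ∀ v → adj v v ≡ false
open Graph public

-- A creation sequence s : Vec Bool m builds a graph on
-- Fin (suc m): start with one vertex; the head of s is the most recently
-- added vertex (index zero), true = dominating, false = isolated.

buildAdj : ∀ {m} → Vec Bool m → Fin (suc m) → Fin (suc m) → Bool
buildAdj []      _       _       = false
buildAdj (b ∷ s) zero    zero    = false
buildAdj (b ∷ s) zero    (suc v) = b
buildAdj (b ∷ s) (suc u) zero    = b
buildAdj (b ∷ s) (suc u) (suc v) = buildAdj s u v

buildSym : ∀ {m} (s : Vec Bool m) u v → buildAdj s u v ≡ buildAdj s v u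
buildSym []      _       _       = _≡_.refl
buildSym (b ∷ s) zero    zero    = _≡_.refl
buildSym (b ∷ s) zero    (suc v) = _≡_.refl
buildSym (b ∷ s) (suc u) zero    = _≡_.refl
buildSym (b ∷ s) (suc u) (suc v) = buildSym s u v

buildIrr : ∀ {m} (s : Vec Bool m) v → buildAdj s v v ≡ false
buildIrr []      _       = _≡_.refl
buildIrr (b ∷ s) zero    = _≡_.refl
buildIrr (b ∷ s) (suc v) = buildIrr s v

build : ∀ {m} → Vec Bool m → Graph (suc m)
build s = record { adj = buildAdj s ; sym = buildSym s ; irref = buildIrr s }

IsThreshold : ∀ {n} → Graph n → Set
IsThreshold {n} G =
  Σ ℕ λ m → Σ (Vec Bool m) λ s → Σ (Fin n → Fin (suc m)) λ σ →
    Bijective _≡_ _≡_ σ × (∀ u v → adj G u v ≡ adj (build s) (σ u) (σ v))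

IsComplete : ∀ {n} → Graph n → Set
IsComplete G = ∀ u v → u ≢ v → adj G u v ≡ true

allSubsets : ∀ n → List (Subset n)
allSubsets zero    = [] ∷ []
allSubsets (suc n) = map (true ∷_) (allSubsets n) ++ map (false ∷_) (allSubsets n)

isClique : ∀ {n} → Graph n → Subset n → Bool
isClique {n} G S =
  all (λ u → all (λ v → not (lookup S u ∧ lookup S v) ∨ does (u ≟ v) ∨ adj G u v)
                  (allFin n))
      (allFin n)

subsetB : ∀ {n} → Subset n → Subset n → Bool
subsetB {n} S T = all (λ v → not (lookup S v) ∨ lookup T v) (allFin n)

strictSubsetB : ∀ {n} → Subset n → Subset n → Bool
strictSubsetB S T = subsetB S T ∧ not (subsetB T S)

isMaximalClique : ∀ {n} → Graph n → Subset n → Bool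
isMaximalClique {n} G S =
  isClique G S ∧ not (any (λ T → isClique G T ∧ strictSubsetB S T) (allSubsets n))

cliqueCount : ∀ {n} → Graph n → ℕ → ℕ
cliqueCount {n} G i =
  length (filter (λ S → isClique G S ≟ᵇ true) (filter (λ S → ∣ S ∣ ℕ.≟ i) (allSubsets n)))

maxCliqueCount : ∀ {n} → Graph n → ℕ → ℕ
maxCliqueCount {n} G i =
  length (filter (λ S → isMaximalClique G S ≟ᵇ true) (filter (λ S → ∣ S ∣ ℕ.≟ i) (allSubsets n)))

IsCliqueNumber : ∀ {n} → Graph n → ℕ → Set
IsCliqueNumber {n} G d =
  (Σ (Subset n) λ S → isClique G S ≡ true × ∣ S ∣ ≡ d) ×
  (∀ S → isClique G S ≡ true → ∣ S ∣ ≤ d)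

data Reach {n} (G : Graph n) (Y : Subset n) : Fin n → Fin n → Set where
  here : ∀ {v} → v ∉ Y → Reach G Y v v
  step : ∀ {u w v} → u ∉ Y → adj G u w ≡ true → Reach G Y w v → Reach G Y u v

IsVertexCut : ∀ {n} → Graph n → Subset n → Set
IsVertexCut G Y = Σ _ λ u → Σ _ λ v → u ∉ Y × v ∉ Y × ¬ Reach G Y u v

IsVertexConnectivity : ∀ {n} → Graph n → ℕ → Set
IsVertexConnectivity G κ =
  (Σ _ λ Y → IsVertexCut G Y × ∣ Y ∣ ≡ κ) × (∀ Y → IsVertexCut G Y → κ ≤ ∣ Y ∣)

IsMinimumVertexCut : ∀ {n} → Graph n → Subset n → Set
IsMinimumVertexCut G Y = IsVertexCut G Y × (∀ Y' → IsVertexCut G Y' → ∣ Y ∣ ≤ ∣ Y' ∣)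

-- W(G - Y) = k : the connected components of G - Y are labelled bijectively
-- by Fin k (a surjective labelling whose fibres are exactly the components).
HasComponents : ∀ {n} → Graph n → Subset n → ℕ → Set
HasComponents {n} G Y k =
  Σ ((v : Fin n) → v ∉ Y → Fin k) λ f →
    (∀ (c : Fin k) → Σ (Fin n) λ v → Σ (v ∉ Y) λ p → f v p ≡ c) ×
    (∀ u v (p : u ∉ Y) (q : v ∉ Y) → (f u p ≡ f v q) ⇔ Reach G Y u v)

IsDominatingClique : ∀ {n} → Graph n → ℕ → List (Subset n) → Set
IsDominatingClique {n} G i F =
  Unique F ×
  (∀ D → D ∈ₗ F → isClique G D ≡ true × ∣ D ∣ ≡ i) ×
  (∀ C → isMaximalClique G C ≡ true → i ≤ ∣ C ∣ → Σ _ λ D → D ∈ₗ F × D ⊆ C)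

IsMinDominating : ∀ {n} → Graph n → ℕ → ℕ → Set
IsMinDominating G i k =
  (Σ _ λ F → IsDominatingClique G i F × length F ≡ k) ×
  (∀ F → IsDominatingClique G i F → k ≤ length F)

sumTo : ℕ → (ℕ → ℤ) → ℤ
sumTo zero    f = + 0
sumTo (suc d) f = sumTo d f ℤ.+ f (suc d)

-- b is the b-vector of G for clique number d:
--   Σ_{i=1}^d b_i (x+1)^{i-1} = Σ_{i=1}^d c_i x^{i-1}  as polynomials,
-- i.e. as functions of x ∈ ℤ.
IsBVector : ∀ {n} → Graph n → ℕ → (ℕ → ℤ) → Set
IsBVector G d b =
  ∀ (x : ℤ) →
    sumTo d (λ i → b i ℤ.* ((x ℤ.+ + 1) ℤ.^ (i ℕ.∸ 1)))
      ≡ sumTo d (λ i → + cliqueCount G i ℤ.* (x ℤ.^ (i ℕ.∸ 1)))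

{-# OPTIONS --safe #-}
-- Up to relabelling, T is the graph built from a creation sequence s.  A dominating step turns the
-- clique polynomial C(x) = Σ c_i x^(i-1) into 1 + (1 + x) C(x), an isolated step into 1 + C(x);
-- so B(y) = C(y - 1) becomes 1 + y B(y) or 1 + B(y), and the b-vector is an explicit sequence of
-- naturals computed along s.  The same recursion counts the maximal cliques, the components left
-- by the minimum cut (the dominating vertices added after the latest isolated one, whose number
-- is κ) and the smallest dominating families, which gives (a)-(d).
module Submission where

open import Defs

open import Data.Bool using (Bool; true; false; T; _∧_; _∨_; not) renaming (_≟_ to _≟ᵇ_)
open import Data.Bool.Properties using (T-≡; T-not-≡; T-∧; ⇔→≡; ¬-not)
open import Data.Bool.ListAction using (all; any)
open import Data.Empty using (⊥-elim)
open import Data.Fin using (Fin; zero; suc; _≟_)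
open import Data.Fin.Properties using (suc-injective)
open import Data.Fin.Subset using (Subset; _∈_; _∉_; _⊆_; ∣_∣; ⁅_⁆; Empty; Nonempty) renaming (⊥ to ∅)
open import Data.Fin.Subset.Properties
  using (_∈?_; nonempty?; drop-there; drop-∷-⊆; drop-∷-Empty; Empty-unique; ∉⊥; ⊥⊆; ∣⊥∣≡0; ∣p∣≤n;
         ⊆-refl; ⊆-antisym; s⊆s; p⊆q⇒∣p∣≤∣q∣; p⊂q⇒∣p∣<∣q∣; x∈⁅x⁆; x∈⁅y⁆⇒x≡y)
import Data.Integer as ℤ
open ℤ using (ℤ; +_; _-_)
import Data.Integer.Properties as ℤₚ
open import Data.Integer.Tactic.RingSolver using (solve-∀)
open import Data.List using (List; []; _∷_; _++_; map; filter; length; allFin; tabulate)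
open import Data.List.Properties
  using (length-map; length-filter; length-++; map-tabulate; filter-≐; filter-++; filter-none; filter-accept)
open import Data.List.Membership.Propositional using () renaming (_∈_ to _∈ₗ_; _∉_ to _∉ₗ_)
open import Data.List.Membership.Propositional.Properties
  using (∈-filter⁺; ∈-filter⁻; ∈-map⁺; ∈-map⁻; ∈-++⁺ˡ; ∈-++⁺ʳ; ∈-allFin)
open import Data.List.Membership.Propositional.Properties.WithK using (unique∧set⇒bag)
import Data.List.Membership.DecPropositional as DecMembership
open import Data.List.Relation.Binary.BagAndSetEquality using (∼bag⇒↭)
open import Data.List.Relation.Binary.Permutation.Propositional using (_↭_)
open import Data.List.Relation.Binary.Permutation.Propositional.Properties using (↭-length; filter-↭)
import Data.List.Relation.Unary.All as All
open import Data.List.Relation.Unary.All.Properties using (all⁺; all⁻)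
open import Data.List.Relation.Unary.Any using (here; there; satisfied)
import Data.List.Relation.Unary.Any as Any
open import Data.List.Relation.Unary.Any.Properties using (any⁺; any⁻)
open import Data.List.Relation.Unary.Unique.Propositional using (Unique)
import Data.List.Relation.Unary.Unique.Propositional.Properties as Unique
import Data.Nat as ℕ
open import Data.Nat using (ℕ; zero; suc; _+_; _∸_; _≤_; _<_; z≤n; s≤s) renaming (_≟_ to _≟ℕ_)
import Data.Nat.Properties as ℕₚ
open ℕₚ using (module ≤-Reasoning)
open import Data.Product using (Σ; ∃; _×_; _,_; proj₁; proj₂)
open import Data.Sum using (_⊎_; inj₁; inj₂)
import Data.Vec as Vec
open import Data.Vec using (Vec; []; _∷_; lookup; here; there)
open import Data.Vec.Properties
  using (∷-injectiveʳ; ≡-dec; []=⇒lookup; lookup⇒[]=; lookup∘tabulate; tabulate∘lookup; tabulate-cong)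
open import Function using (id; _∘_; case_of_; Bijective; _⇔_; mk⇔; Equivalence)
open import Function.Properties.Equivalence using () renaming (trans to ⇔-trans; sym to ⇔-sym)
open import Relation.Binary.Definitions using (DecidableEquality)
import Relation.Binary.PropositionalEquality as ≡
open ≡ using (_≡_; _≢_; refl; trans; cong; cong₂; subst; subst₂; module ≡-Reasoning)
open import Relation.Nullary using (¬_; does; yes; no)
open import Relation.Unary using (Decidable; _≐_)

module _ {A : Set} where

  unique-set⇒↭ : ∀ {xs ys : List A} → Unique xs → Unique ys →
                 (∀ {z} → z ∈ₗ xs ⇔ z ∈ₗ ys) → xs ↭ ys
  unique-set⇒↭ ux uy xs≈ys = ∼bag⇒↭ (unique∧set⇒bag ux uy xs≈ys)

  unique-⊆⇒length≤ : DecidableEquality A → ∀ {xs ys : List A} → Unique xs → Unique ys →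
                     (∀ {z} → z ∈ₗ xs → z ∈ₗ ys) → length xs ≤ length ys
  unique-⊆⇒length≤ _≟ₐ_ {xs} {ys} ux uy xs⊆ys = begin
    length xs                   ≡⟨ ↭-length (unique-set⇒↭ ux (Unique.filter⁺ ∈xs? uy) xs≈ys) ⟩
    length (filter ∈xs? ys)     ≤⟨ length-filter ∈xs? ys ⟩
    length ys                   ∎
    where
    open ≤-Reasoning
    open DecMembership _≟ₐ_ using () renaming (_∈?_ to _∈ₗ?_)
    ∈xs? : Decidable (_∈ₗ xs)
    ∈xs? z = z ∈ₗ? xs
    xs≈ys : ∀ {z} → z ∈ₗ xs ⇔ z ∈ₗ filter ∈xs? ys
    xs≈ys = mk⇔ (λ z∈xs → ∈-filter⁺ ∈xs? (xs⊆ys z∈xs) z∈xs) (proj₂ ∘ ∈-filter⁻ ∈xs? {xs = ys})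

module _ {A B : Set} where

  filter-map : ∀ {P : B → Set} (P? : Decidable P) (f : A → B) xs →
               filter P? (map f xs) ≡ map f (filter (P? ∘ f) xs)
  filter-map P? f []       = refl
  filter-map P? f (x ∷ xs) with does (P? (f x))
  ... | true  = cong (f x ∷_) (filter-map P? f xs)
  ... | false = filter-map P? f xs

  length-filter-map : ∀ {P : B → Set} (P? : Decidable P) (f : A → B) xs →
                      length (filter P? (map f xs)) ≡ length (filter (P? ∘ f) xs)
  length-filter-map P? f xs = trans (cong length (filter-map P? f xs)) (length-map f (filter (P? ∘ f) xs))

  length-filter²-map : ∀ {P Q : B → Set} (P? : Decidable P) (Q? : Decidable Q) (f : A → B) xs →
                       length (filter P? (filter Q? (map f xs))) ≡ length (filter (P? ∘ f) (filter (Q? ∘ f) xs))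
  length-filter²-map P? Q? f xs =
    trans (cong (length ∘ filter P?) (filter-map Q? f xs)) (length-filter-map P? f (filter (Q? ∘ f) xs))

reflects-⇔⇒≡ : ∀ {b c : Bool} {P Q : Set} → b ≡ true ⇔ P → c ≡ true ⇔ Q → P ⇔ Q → b ≡ c
reflects-⇔⇒≡ b⇔P c⇔Q P⇔Q = ⇔→≡ (⇔-trans b⇔P (⇔-trans P⇔Q (⇔-sym c⇔Q)))

≗⇒≡-≐ : ∀ {A B : Set} {f g : A → B} {c} → (∀ x → f x ≡ g x) → (λ x → f x ≡ c) ≐ (λ x → g x ≡ c)
≗⇒≡-≐ f≗g = (λ {x} → trans (≡.sym (f≗g x))) , (λ {x} → trans (f≗g x))

-- Subsets

allSubsets-complete : ∀ {n} (S : Subset n) → S ∈ₗ allSubsets n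
allSubsets-complete []                = here refl
allSubsets-complete {suc n} (true ∷ S)  = ∈-++⁺ˡ (∈-map⁺ (true ∷_) (allSubsets-complete S))
allSubsets-complete {suc n} (false ∷ S) =
  ∈-++⁺ʳ (map (true ∷_) (allSubsets n)) (∈-map⁺ (false ∷_) (allSubsets-complete S))

allSubsets-unique : ∀ n → Unique (allSubsets n)
allSubsets-unique zero    = All.[] Unique.∷ Unique.[]
allSubsets-unique (suc n) =
  Unique.++⁺ (Unique.map⁺ ∷-injectiveʳ (allSubsets-unique n))
             (Unique.map⁺ ∷-injectiveʳ (allSubsets-unique n)) disjoint
  where
  disjoint : ∀ {S} → ¬ (S ∈ₗ map (true ∷_) (allSubsets n) × S ∈ₗ map (false ∷_) (allSubsets n))
  disjoint (S∈true , S∈false) with ∈-map⁻ (true ∷_) S∈true | ∈-map⁻ (false ∷_) S∈false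
  ... | _ , _ , refl | _ , _ , ()

∣p∣≡count-∈ : ∀ {n} (S : Subset n) → ∣ S ∣ ≡ length (filter (_∈? S) (allFin n))
∣p∣≡count-∈-∷ : ∀ {n} x (S : Subset n) → ∣ S ∣ ≡ length (filter (_∈? (x ∷ S)) (tabulate suc))

∣p∣≡count-∈ []          = refl
∣p∣≡count-∈ (true ∷ S)  = cong suc (∣p∣≡count-∈-∷ true S)
∣p∣≡count-∈ (false ∷ S) = ∣p∣≡count-∈-∷ false S

∣p∣≡count-∈-∷ {n} x S = begin
  ∣ S ∣
    ≡⟨ ∣p∣≡count-∈ S ⟩
  length (filter (_∈? S) (allFin n))
    ≡⟨ cong length (filter-≐ _ _ (there , drop-there) (allFin n)) ⟩
  length (filter ((_∈? (x ∷ S)) ∘ suc) (allFin n))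
    ≡˘⟨ length-filter-map (_∈? (x ∷ S)) suc (allFin n) ⟩
  length (filter (_∈? (x ∷ S)) (map suc (allFin n)))
    ≡⟨ cong (length ∘ filter (_∈? (x ∷ S))) (map-tabulate id suc) ⟩
  length (filter (_∈? (x ∷ S)) (tabulate suc)) ∎
  where open ≡-Reasoning

⊆∧∣⊇∣⇒≡ : ∀ {n} {S S′ : Subset n} → S ⊆ S′ → ∣ S′ ∣ ≤ ∣ S ∣ → S ≡ S′
⊆∧∣⊇∣⇒≡ {S = S} {S′} S⊆S′ ∣S′∣≤∣S∣ = ⊆-antisym S⊆S′ S′⊆S
  where
  S′⊆S : S′ ⊆ S
  S′⊆S {v} v∈S′ with v ∈? S
  ... | yes v∈S = v∈S
  ... | no  v∉S = ⊥-elim (ℕₚ.<⇒≱ (p⊂q⇒∣p∣<∣q∣ (S⊆S′ , v , v∈S′ , v∉S)) ∣S′∣≤∣S∣)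

Empty⇒∣p∣≡0 : ∀ {n} {S : Subset n} → Empty S → ∣ S ∣ ≡ 0
Empty⇒∣p∣≡0 {n} empty = trans (cong ∣_∣ (Empty-unique empty)) (∣⊥∣≡0 n)

Empty-∷⇔ : ∀ {n} {S : Subset n} → Empty (false ∷ S) ⇔ Empty S
Empty-∷⇔ = mk⇔ drop-∷-Empty λ { e (zero , ()) ; e (suc v , there v∈) → e (v , v∈) }

-- Cliques

Clique : ∀ {n} → Graph n → Subset n → Set
Clique G S = ∀ {u v} → u ∈ S → v ∈ S → u ≢ v → adj G u v ≡ true

MaximalClique : ∀ {n} → Graph n → Subset n → Set
MaximalClique G S = Clique G S × (∀ S′ → Clique G S′ → S ⊆ S′ → S′ ⊆ S)

module _ {n} (G : Graph n) (S : Subset n) where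

  private
    pair-ok : Fin n → Fin n → Bool
    pair-ok u v = not (lookup S u ∧ lookup S v) ∨ does (u ≟ v) ∨ adj G u v

    pair-ok⇒adj : ∀ u v → T (pair-ok u v) → u ∈ S → v ∈ S → u ≢ v → adj G u v ≡ true
    pair-ok⇒adj u v ok u∈S v∈S u≢v rewrite []=⇒lookup u∈S | []=⇒lookup v∈S with u ≟ v
    ... | yes u≡v = ⊥-elim (u≢v u≡v)
    ... | no  _   = Equivalence.to T-≡ ok

    adj⇒pair-ok : ∀ u v → (u ∈ S → v ∈ S → u ≢ v → adj G u v ≡ true) → T (pair-ok u v)
    adj⇒pair-ok u v uv-adj with lookup S u in eu | lookup S v in ev | u ≟ v
    ... | false | _     | _       = _
    ... | true  | false | _       = _
    ... | true  | true  | yes _   = _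
    ... | true  | true  | no u≢v  =
      Equivalence.from T-≡ (uv-adj (lookup⇒[]= u S eu) (lookup⇒[]= v S ev) u≢v)

    row-ok : Fin n → Bool
    row-ok u = all (pair-ok u) (allFin n)

  isClique⇔Clique : isClique G S ≡ true ⇔ Clique G S
  isClique⇔Clique = mk⇔ to from
    where
    to : isClique G S ≡ true → Clique G S
    to e {u} {v} = pair-ok⇒adj u v (All.lookup (all⁺ (pair-ok u) (allFin n) row) (∈-allFin v))
      where row = All.lookup (all⁺ row-ok (allFin n) (Equivalence.from T-≡ e)) (∈-allFin u)
    from : Clique G S → isClique G S ≡ true
    from c = Equivalence.to T-≡ (all⁻ row-ok {xs = allFin n} (All.tabulate λ {u} _ →
                                   all⁻ (pair-ok u) {xs = allFin n} (All.tabulate λ {v} _ → adj⇒pair-ok u v c)))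

subsetB⇔⊆ : ∀ {n} (S S′ : Subset n) → subsetB S S′ ≡ true ⇔ S ⊆ S′
subsetB⇔⊆ {n} S S′ = mk⇔ to from
  where
  entry : Fin n → Bool
  entry v = not (lookup S v) ∨ lookup S′ v
  to : subsetB S S′ ≡ true → S ⊆ S′
  to e {v} v∈S =
    lookup⇒[]= v S′ (entry-ok (All.lookup (all⁺ entry (allFin n) (Equivalence.from T-≡ e)) (∈-allFin v)))
    where
    entry-ok : T (entry v) → lookup S′ v ≡ true
    entry-ok ok rewrite []=⇒lookup v∈S = Equivalence.to T-≡ ok
  from : S ⊆ S′ → subsetB S S′ ≡ true
  from S⊆S′ = Equivalence.to T-≡ (all⁻ entry {xs = allFin n} (All.tabulate λ {v} _ → entry-ok v))
    where
    entry-ok : ∀ v → T (entry v)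
    entry-ok v with lookup S v in e
    ... | false = _
    ... | true  = Equivalence.from T-≡ ([]=⇒lookup (S⊆S′ (lookup⇒[]= v S e)))

module _ {n} (G : Graph n) (S : Subset n) where

  private
    enlarges : Subset n → Bool
    enlarges S′ = isClique G S′ ∧ strictSubsetB S S′

    no-enlargement : (∀ S′ → Clique G S′ → S ⊆ S′ → S′ ⊆ S) → any enlarges (allSubsets n) ≡ false
    no-enlargement maximal with any enlarges (allSubsets n) in e
    ... | false = refl
    ... | true with satisfied (any⁻ enlarges (allSubsets n) (subst T (≡.sym e) _))
    ...   | S′ , enl with Equivalence.to T-∧ enl
    ...     | c , strict with Equivalence.to T-∧ strict
    ...       | S⊆S′ , S′⊈S =
      trans (≡.sym (Equivalence.from (subsetB⇔⊆ S′ S)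
                      (maximal S′ (Equivalence.to (isClique⇔Clique G S′) (Equivalence.to T-≡ c))
                                  (Equivalence.to (subsetB⇔⊆ S S′) (Equivalence.to T-≡ S⊆S′)))))
            (Equivalence.to T-not-≡ S′⊈S)

  isMaximalClique⇔MaximalClique : isMaximalClique G S ≡ true ⇔ MaximalClique G S
  isMaximalClique⇔MaximalClique = mk⇔ to from
    where
    to : isMaximalClique G S ≡ true → MaximalClique G S
    to e with isClique G S in clq | any enlarges (allSubsets n) in none
    to () | false | _
    to () | true  | true
    to _  | true  | false = Equivalence.to (isClique⇔Clique G S) clq , maximal
      where
      maximal : ∀ S′ → Clique G S′ → S ⊆ S′ → S′ ⊆ S
      maximal S′ c S⊆S′ with subsetB S′ S in back
      ... | true  = Equivalence.to (subsetB⇔⊆ S′ S) back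
      ... | false =
        ⊥-elim (subst T none (any⁺ enlarges (Any.map (λ { refl → enlarged }) (allSubsets-complete S′))))
        where
        enlarged : T (enlarges S′)
        enlarged rewrite Equivalence.from (isClique⇔Clique G S′) c
                       | Equivalence.from (subsetB⇔⊆ S S′) S⊆S′ | back = _
    from : MaximalClique G S → isMaximalClique G S ≡ true
    from (c , maximal) rewrite Equivalence.from (isClique⇔Clique G S) c | no-enlargement maximal = refl

Clique-⁅⁆ : ∀ {n} (G : Graph n) x → Clique G ⁅ x ⁆
Clique-⁅⁆ G x u∈ v∈ u≢v = ⊥-elim (u≢v (trans (x∈⁅y⁆⇒x≡y x u∈) (≡.sym (x∈⁅y⁆⇒x≡y x v∈))))

MaximalClique-nonempty : ∀ {n} {G : Graph (suc n)} {S} → MaximalClique G S → Nonempty S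
MaximalClique-nonempty {G = G} {S} (_ , maximal) with nonempty? S
... | yes nonempty = nonempty
... | no  empty = zero , maximal ⁅ zero ⁆ (Clique-⁅⁆ G zero) (λ x∈S → ⊥-elim (empty (_ , x∈S))) (x∈⁅x⁆ zero)

-- Dominating cliques

module _ {n} (G : Graph n) where

  maximalCliquesOfSize : ℕ → List (Subset n)
  maximalCliquesOfSize i =
    filter (λ S → isMaximalClique G S ≟ᵇ true) (filter (λ S → ∣ S ∣ ≟ℕ i) (allSubsets n))

  maximalCliquesOfSize-unique : ∀ i → Unique (maximalCliquesOfSize i)
  maximalCliquesOfSize-unique i = Unique.filter⁺ _ (Unique.filter⁺ _ (allSubsets-unique n))

  ∈-maximalCliquesOfSize⇔ : ∀ {i S} → S ∈ₗ maximalCliquesOfSize i ⇔ (MaximalClique G S × ∣ S ∣ ≡ i)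
  ∈-maximalCliquesOfSize⇔ {i} {S} = mk⇔ to from
    where
    sized = filter (λ S → ∣ S ∣ ≟ℕ i) (allSubsets n)
    to : S ∈ₗ maximalCliquesOfSize i → MaximalClique G S × ∣ S ∣ ≡ i
    to S∈ with S∈sized , isMax ← ∈-filter⁻ (λ S → isMaximalClique G S ≟ᵇ true) {xs = sized} S∈ =
      Equivalence.to (isMaximalClique⇔MaximalClique G S) isMax ,
      proj₂ (∈-filter⁻ (λ S → ∣ S ∣ ≟ℕ i) {xs = allSubsets n} S∈sized)
    from : MaximalClique G S × ∣ S ∣ ≡ i → S ∈ₗ maximalCliquesOfSize i
    from (max , ∣S∣≡i) = ∈-filter⁺ _ (∈-filter⁺ _ (allSubsets-complete S) ∣S∣≡i)
                                     (Equivalence.from (isMaximalClique⇔MaximalClique G S) max)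

  maximalCliquesOfSize-cliques : ∀ {i S} → S ∈ₗ maximalCliquesOfSize i → isClique G S ≡ true × ∣ S ∣ ≡ i
  maximalCliquesOfSize-cliques {S = S} S∈ with (c , _) , ∣S∣≡i ← Equivalence.to ∈-maximalCliquesOfSize⇔ S∈ =
    Equivalence.from (isClique⇔Clique G S) c , ∣S∣≡i

  -- A maximal clique of size i can only be dominated by itself.
  dominating-⊇-maximalCliquesOfSize : ∀ {i F} → IsDominatingClique G i F →
                                      ∀ {C} → C ∈ₗ maximalCliquesOfSize i → C ∈ₗ F
  dominating-⊇-maximalCliquesOfSize (_ , in-F , dominates) {C} C∈
    with max , ∣C∣≡i ← Equivalence.to ∈-maximalCliquesOfSize⇔ C∈
    with D , D∈F , D⊆C ← dominates C (Equivalence.from (isMaximalClique⇔MaximalClique G C) max)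
                                     (ℕₚ.≤-reflexive (≡.sym ∣C∣≡i)) =
    subst (_∈ₗ _) (⊆∧∣⊇∣⇒≡ D⊆C (ℕₚ.≤-reflexive (trans ∣C∣≡i (≡.sym ∣D∣≡i)))) D∈F
    where ∣D∣≡i = proj₂ (in-F D D∈F)

  ∉-maximalCliquesOfSize : ∀ {i K D} → MaximalClique G K → i < ∣ K ∣ → D ⊆ K → D ∉ₗ maximalCliquesOfSize i
  ∉-maximalCliquesOfSize {K = K} (cK , _) i<∣K∣ D⊆K D∈
    with (_ , maximal) , ∣D∣≡i ← Equivalence.to ∈-maximalCliquesOfSize⇔ D∈ =
    ℕₚ.<⇒≱ i<∣K∣ (subst (∣ K ∣ ≤_) ∣D∣≡i (p⊆q⇒∣p∣≤∣q∣ (maximal K cK D⊆K)))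

  minDominating-top : ∀ {d} → IsCliqueNumber G d → IsMinDominating G d (maxCliqueCount G d)
  minDominating-top {d} (_ , bound) = (L , L-dominating , refl) , λ F F-dom →
    unique-⊆⇒length≤ (≡-dec _≟ᵇ_) (maximalCliquesOfSize-unique d) (proj₁ F-dom)
                     (dominating-⊇-maximalCliquesOfSize F-dom)
    where
    L = maximalCliquesOfSize d
    dominated : ∀ C → MaximalClique G C → d ≤ ∣ C ∣ → Σ _ λ D → D ∈ₗ L × D ⊆ C
    dominated C max d≤∣C∣ =
      C , Equivalence.from ∈-maximalCliquesOfSize⇔ (max , ℕₚ.≤-antisym ∣C∣≤d d≤∣C∣) , ⊆-refl
      where ∣C∣≤d = bound C (Equivalence.from (isClique⇔Clique G C) (proj₁ max))
    L-dominating : IsDominatingClique G d L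
    L-dominating = maximalCliquesOfSize-unique d , (λ _ → maximalCliquesOfSize-cliques) ,
                   λ C → dominated C ∘ Equivalence.to (isMaximalClique⇔MaximalClique G C)

  -- Besides the maximal cliques of size exactly i, a dominating family needs an i-clique inside K;
  -- a single i-clique D lying in every larger maximal clique suffices.
  minDominating-below : ∀ {i K D} → MaximalClique G K → i < ∣ K ∣ →
                        Clique G D → ∣ D ∣ ≡ i → (∀ C → MaximalClique G C → i < ∣ C ∣ → D ⊆ C) →
                        IsMinDominating G i (suc (maxCliqueCount G i))
  minDominating-below {i} {K} {D} maxK i<∣K∣ cD ∣D∣≡i D⊆large = (D ∷ L , D∷L-dominating , refl) , lower-bound
    where
    L = maximalCliquesOfSize i
    fresh : ∀ {D′} → D′ ⊆ K → All.All (D′ ≢_) L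
    fresh D′⊆K = All.tabulate λ D″∈L D′≡D″ →
      ∉-maximalCliquesOfSize maxK i<∣K∣ D′⊆K (subst (_∈ₗ L) (≡.sym D′≡D″) D″∈L)
    dominated : ∀ C → MaximalClique G C → i ≤ ∣ C ∣ → Σ _ λ D′ → D′ ∈ₗ D ∷ L × D′ ⊆ C
    dominated C max i≤∣C∣ with ∣ C ∣ ≟ℕ i
    ... | yes ∣C∣≡i = C , there (Equivalence.from ∈-maximalCliquesOfSize⇔ (max , ∣C∣≡i)) , ⊆-refl
    ... | no  ∣C∣≢i = D , here refl , D⊆large C max (ℕₚ.≤∧≢⇒< i≤∣C∣ (∣C∣≢i ∘ ≡.sym))
    D∷L-dominating : IsDominatingClique G i (D ∷ L)
    D∷L-dominating =
      fresh (D⊆large K maxK i<∣K∣) Unique.∷ maximalCliquesOfSize-unique i ,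
      (λ { _ (here refl) → Equivalence.from (isClique⇔Clique G D) cD , ∣D∣≡i
         ; _ (there D′∈L) → maximalCliquesOfSize-cliques D′∈L }) ,
      λ C → dominated C ∘ Equivalence.to (isMaximalClique⇔MaximalClique G C)
    lower-bound : ∀ F → IsDominatingClique G i F → suc (length L) ≤ length F
    lower-bound F F-dom@(F-unique , _ , dominates)
      with D′ , D′∈F , D′⊆K ← dominates K (Equivalence.from (isMaximalClique⇔MaximalClique G K) maxK)
                                          (ℕₚ.<⇒≤ i<∣K∣) =
      unique-⊆⇒length≤ (≡-dec _≟ᵇ_) (fresh D′⊆K Unique.∷ maximalCliquesOfSize-unique i) F-unique
        λ { (here refl) → D′∈F ; (there D″∈L) → dominating-⊇-maximalCliquesOfSize F-dom D″∈L }

-- Reachability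

Reach-start : ∀ {n} {G : Graph n} {Y a b} → Reach G Y a b → a ∉ Y
Reach-start (here a∉)     = a∉
Reach-start (step a∉ _ _) = a∉

Reach-++ : ∀ {n} {G : Graph n} {Y a b c} → Reach G Y a b → Reach G Y b c → Reach G Y a c
Reach-++ (here _)      r₂ = r₂
Reach-++ (step a∉ e r₁) r₂ = step a∉ e (Reach-++ r₁ r₂)

label-irrelevant : ∀ {n} {G : Graph n} {Y k} ((f , _) : HasComponents G Y k) →
                   ∀ {u v} (p : u ∉ Y) (q : v ∉ Y) → u ≡ v → f u p ≡ f v q
label-irrelevant (_ , _ , f-exact) {u} p q refl = Equivalence.from (f-exact u u p q) (here p)

Reach-from-enclosed : ∀ {n} {G : Graph n} {Y x y} → (∀ {w} → adj G x w ≡ true → w ∈ Y) →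
                      Reach G Y x y → x ≡ y
Reach-from-enclosed enclosed (here _)     = refl
Reach-from-enclosed enclosed (step _ e r) = ⊥-elim (Reach-start r (enclosed e))

Universal : ∀ {n} → Graph n → Fin n → Set
Universal G w = ∀ {v} → w ≢ v → adj G w v ≡ true

module _ {n} {G : Graph n} {Y : Subset n} {w : Fin n} (universal : Universal G w) where

  reach-universal : w ∉ Y → ∀ {a} → a ∉ Y → Reach G Y a w
  reach-universal w∉ {a} a∉ with a ≟ w
  ... | yes refl = here a∉
  ... | no  a≢w  = step a∉ (trans (Graph.sym G a w) (universal (a≢w ∘ ≡.sym))) (here w∉)

  universal-connects : w ∉ Y → ∀ {a b} → a ∉ Y → b ∉ Y → Reach G Y a b
  universal-connects w∉ {a} {b} a∉ b∉ with b ≟ w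
  ... | yes refl = reach-universal w∉ a∉
  ... | no  b≢w  = Reach-++ (reach-universal w∉ a∉) (step w∉ (universal (b≢w ∘ ≡.sym)) (here b∉))

  universal-∈-cut : IsVertexCut G Y → w ∈ Y
  universal-∈-cut (a , b , a∉ , b∉ , ¬a⇝b) with w ∈? Y
  ... | yes w∈ = w∈
  ... | no  w∉ = ⊥-elim (¬a⇝b (universal-connects w∉ a∉ b∉))

universal⇒connected : ∀ {n} {G : Graph n} {w} → Universal G w → HasComponents G ∅ 1
universal⇒connected {w = w} universal = (λ _ _ → zero) , (λ { zero → w , ∉⊥ , refl }) ,
  λ u v u∉ v∉ → mk⇔ (λ _ → universal-connects universal ∉⊥ u∉ v∉) (λ _ → refl)

-- Graph isomorphisms

record GraphIso {n n′} (G : Graph n) (H : Graph n′) : Set where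
  field
    to      : Fin n → Fin n′
    from    : Fin n′ → Fin n
    to∘from : ∀ y → to (from y) ≡ y
    from∘to : ∀ x → from (to x) ≡ x
    adj-to  : ∀ u v → adj G u v ≡ adj H (to u) (to v)

  to-injective : ∀ {x y} → to x ≡ to y → x ≡ y
  to-injective {x} {y} tx≡ty = trans (≡.sym (from∘to x)) (trans (cong from tx≡ty) (from∘to y))

bijective⇒GraphIso : ∀ {n n′} {G : Graph n} {H : Graph n′} (σ : Fin n → Fin n′) → Bijective _≡_ _≡_ σ →
                     (∀ u v → adj G u v ≡ adj H (σ u) (σ v)) → GraphIso G H
bijective⇒GraphIso σ (σ-inj , σ-surj) adj-σ = record
  { to      = σ
  ; from    = λ y → proj₁ (σ-surj y)
  ; to∘from = λ y → proj₂ (σ-surj y) refl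
  ; from∘to = λ x → σ-inj (proj₂ (σ-surj (σ x)) refl)
  ; adj-to  = adj-σ
  }

GraphIso-sym : ∀ {n n′} {G : Graph n} {H : Graph n′} → GraphIso G H → GraphIso H G
GraphIso-sym {H = H} I = record
  { to      = from
  ; from    = to
  ; to∘from = from∘to
  ; from∘to = to∘from
  ; adj-to  = λ u v →
      trans (cong₂ (adj H) (≡.sym (to∘from u)) (≡.sym (to∘from v))) (≡.sym (adj-to (from u) (from v)))
  }
  where open GraphIso I

pull : ∀ {n n′} {G : Graph n} {H : Graph n′} → GraphIso G H → Subset n′ → Subset n
pull I S = Vec.tabulate (lookup S ∘ GraphIso.to I)

module _ {n n′} {G : Graph n} {H : Graph n′} (I : GraphIso G H) where
  open GraphIso I

  ∈-pull⇔ : ∀ {S u} → u ∈ pull I S ⇔ to u ∈ S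
  ∈-pull⇔ {S} {u} = mk⇔
    (λ u∈ → lookup⇒[]= (to u) S (trans (≡.sym (lookup∘tabulate (lookup S ∘ to) u)) ([]=⇒lookup u∈)))
    (λ tu∈ → lookup⇒[]= u (pull I S) (trans (lookup∘tabulate (lookup S ∘ to) u) ([]=⇒lookup tu∈)))

  pull-pull-sym : ∀ S → pull I (pull (GraphIso-sym I) S) ≡ S
  pull-pull-sym S = trans
    (tabulate-cong λ v → trans (lookup∘tabulate (lookup S ∘ from) (to v)) (cong (lookup S) (from∘to v)))
    (tabulate∘lookup S)

  ⊆-pull : ∀ {S S′} → S ⊆ S′ → pull I S ⊆ pull I S′
  ⊆-pull S⊆S′ = Equivalence.from ∈-pull⇔ ∘ S⊆S′ ∘ Equivalence.to ∈-pull⇔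

  Clique-pull : ∀ {S} → Clique H S → Clique G (pull I S)
  Clique-pull c {u} {v} u∈ v∈ u≢v =
    trans (adj-to u v) (c (Equivalence.to ∈-pull⇔ u∈) (Equivalence.to ∈-pull⇔ v∈) (u≢v ∘ to-injective))

  Reach-pull : ∀ {Y a b} → Reach G (pull I Y) a b → Reach H Y (to a) (to b)
  Reach-pull (here a∉)     = here (a∉ ∘ Equivalence.from ∈-pull⇔)
  Reach-pull (step a∉ e r) = step (a∉ ∘ Equivalence.from ∈-pull⇔) (trans (≡.sym (adj-to _ _)) e) (Reach-pull r)

  IsComplete-iso : IsComplete H → IsComplete G
  IsComplete-iso complete u v u≢v = trans (adj-to u v) (complete (to u) (to v) (u≢v ∘ to-injective))

module _ {n n′} {G : Graph n} {H : Graph n′} (I : GraphIso G H) where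
  open GraphIso I
  private
    I⁻¹ = GraphIso-sym I

  Clique-pull⇔ : ∀ {S} → Clique G (pull I S) ⇔ Clique H S
  Clique-pull⇔ {S} = mk⇔ (subst (Clique H) (pull-pull-sym I⁻¹ S) ∘ Clique-pull I⁻¹) (Clique-pull I)

  MaximalClique-pull : ∀ {S} → MaximalClique H S → MaximalClique G (pull I S)
  MaximalClique-pull {S} (c , maximal) = Clique-pull I c , maximal′
    where
    maximal′ : ∀ S′ → Clique G S′ → pull I S ⊆ S′ → S′ ⊆ pull I S
    maximal′ S′ c′ pS⊆S′ = subst (_⊆ pull I S) (pull-pull-sym I S′)
      (⊆-pull I (maximal (pull I⁻¹ S′) (Clique-pull I⁻¹ c′)
                         (subst (_⊆ pull I⁻¹ S′) (pull-pull-sym I⁻¹ S) (⊆-pull I⁻¹ pS⊆S′))))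

  Reach-pull⇔ : ∀ {Y a b} → Reach G (pull I Y) a b ⇔ Reach H Y (to a) (to b)
  Reach-pull⇔ {Y} {a} {b} = mk⇔ (Reach-pull I) λ r →
    subst₂ (Reach G (pull I Y)) (from∘to a) (from∘to b)
      (Reach-pull I⁻¹ (subst (λ Z → Reach H Z (to a) (to b)) (≡.sym (pull-pull-sym I⁻¹ Y)) r))

  from-∉-pull : ∀ {Y w} → w ∉ Y → from w ∉ pull I Y
  from-∉-pull {Y} {w} w∉ = w∉ ∘ subst (_∈ Y) (to∘from w) ∘ Equivalence.to (∈-pull⇔ I)

  IsVertexCut-pull : ∀ {Y} → IsVertexCut H Y → IsVertexCut G (pull I Y)
  IsVertexCut-pull {Y} (a , b , a∉ , b∉ , ¬a⇝b) =
    from a , from b , from-∉-pull a∉ , from-∉-pull b∉ ,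
    ¬a⇝b ∘ subst₂ (Reach H Y) (to∘from a) (to∘from b) ∘ Reach-pull I

  HasComponents-pull : ∀ {Y k} → HasComponents H Y k → HasComponents G (pull I Y) k
  HasComponents-pull {Y} {k} comps@(f , f-onto , f-exact) = F , F-onto , F-exact
    where
    to∉ : ∀ {v} → v ∉ pull I Y → to v ∉ Y
    to∉ v∉ = v∉ ∘ Equivalence.from (∈-pull⇔ I)
    F : (v : Fin n) → v ∉ pull I Y → Fin k
    F v v∉ = f (to v) (to∉ v∉)
    F-onto : ∀ c → Σ (Fin n) λ v → Σ (v ∉ pull I Y) λ v∉ → F v v∉ ≡ c
    F-onto c with f-onto c
    ... | w , w∉ , fw≡c = from w , from-∉-pull w∉ , trans (label-irrelevant comps _ w∉ (to∘from w)) fw≡c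
    F-exact : ∀ u v (p : u ∉ pull I Y) (q : v ∉ pull I Y) → (F u p ≡ F v q) ⇔ Reach G (pull I Y) u v
    F-exact u v p q = ⇔-trans (f-exact (to u) (to v) (to∉ p) (to∉ q)) (⇔-sym Reach-pull⇔)

module _ {n n′} {G : Graph n} {H : Graph n′} (I : GraphIso G H) where
  open GraphIso I
  private
    I⁻¹ = GraphIso-sym I

  MaximalClique-pull⇔ : ∀ {S} → MaximalClique G (pull I S) ⇔ MaximalClique H S
  MaximalClique-pull⇔ {S} =
    mk⇔ (subst (MaximalClique H) (pull-pull-sym I⁻¹ S) ∘ MaximalClique-pull I⁻¹) (MaximalClique-pull I)

  isClique-pull : ∀ S → isClique G (pull I S) ≡ isClique H S
  isClique-pull S = reflects-⇔⇒≡ (isClique⇔Clique G (pull I S)) (isClique⇔Clique H S) (Clique-pull⇔ I)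

  isMaximalClique-pull : ∀ S → isMaximalClique G (pull I S) ≡ isMaximalClique H S
  isMaximalClique-pull S =
    reflects-⇔⇒≡ (isMaximalClique⇔MaximalClique G (pull I S)) (isMaximalClique⇔MaximalClique H S)
                 MaximalClique-pull⇔

  map-to-allFin↭ : map to (allFin n) ↭ allFin n′
  map-to-allFin↭ = unique-set⇒↭ (Unique.map⁺ to-injective (Unique.allFin⁺ n)) (Unique.allFin⁺ n′) λ {z} →
    mk⇔ (λ _ → ∈-allFin z) (λ _ → subst (_∈ₗ map to (allFin n)) (to∘from z) (∈-map⁺ to (∈-allFin (from z))))

  ∣pull∣ : ∀ S → ∣ pull I S ∣ ≡ ∣ S ∣
  ∣pull∣ S = begin
    ∣ pull I S ∣                                 ≡⟨ ∣p∣≡count-∈ (pull I S) ⟩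
    length (filter (_∈? pull I S) (allFin n))    ≡⟨ cong length (filter-≐ _ _ ∈-pull≐ (allFin n)) ⟩
    length (filter ((_∈? S) ∘ to) (allFin n))    ≡˘⟨ length-filter-map (_∈? S) to (allFin n) ⟩
    length (filter (_∈? S) (map to (allFin n)))  ≡⟨ ↭-length (filter-↭ (_∈? S) map-to-allFin↭) ⟩
    length (filter (_∈? S) (allFin n′))          ≡˘⟨ ∣p∣≡count-∈ S ⟩
    ∣ S ∣                                        ∎
    where
    open ≡-Reasoning
    ∈-pull≐ : (_∈ pull I S) ≐ ((_∈ S) ∘ to)
    ∈-pull≐ = Equivalence.to (∈-pull⇔ I) , Equivalence.from (∈-pull⇔ I)

  map-pull-allSubsets↭ : map (pull I) (allSubsets n′) ↭ allSubsets n
  map-pull-allSubsets↭ =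
    unique-set⇒↭ (Unique.map⁺ pull-injective (allSubsets-unique n′)) (allSubsets-unique n) λ {S} →
      mk⇔ (λ _ → allSubsets-complete S)
          (λ _ → subst (_∈ₗ map (pull I) (allSubsets n′)) (pull-pull-sym I S)
                       (∈-map⁺ (pull I) (allSubsets-complete (pull I⁻¹ S))))
    where
    pull-injective : ∀ {S S′} → pull I S ≡ pull I S′ → S ≡ S′
    pull-injective {S} {S′} eq =
      trans (≡.sym (pull-pull-sym I⁻¹ S)) (trans (cong (pull I⁻¹) eq) (pull-pull-sym I⁻¹ S′))

  count-pull : ∀ {P Q : Subset n → Set} {P′ Q′ : Subset n′ → Set}
               (P? : Decidable P) (Q? : Decidable Q) (P′? : Decidable P′) (Q′? : Decidable Q′) →
               (P ∘ pull I) ≐ P′ → (Q ∘ pull I) ≐ Q′ →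
               length (filter P? (filter Q? (allSubsets n))) ≡ length (filter P′? (filter Q′? (allSubsets n′)))
  count-pull P? Q? P′? Q′? P≐P′ Q≐Q′ = begin
    length (filter P? (filter Q? (allSubsets n)))
      ≡˘⟨ ↭-length (filter-↭ P? (filter-↭ Q? map-pull-allSubsets↭)) ⟩
    length (filter P? (filter Q? (map (pull I) (allSubsets n′))))
      ≡⟨ length-filter²-map P? Q? (pull I) (allSubsets n′) ⟩
    length (filter (P? ∘ pull I) (filter (Q? ∘ pull I) (allSubsets n′)))
      ≡⟨ cong length (filter-≐ (P? ∘ pull I) P′? P≐P′ (filter (Q? ∘ pull I) (allSubsets n′))) ⟩
    length (filter P′? (filter (Q? ∘ pull I) (allSubsets n′)))
      ≡⟨ cong (length ∘ filter P′?) (filter-≐ (Q? ∘ pull I) Q′? Q≐Q′ (allSubsets n′)) ⟩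
    length (filter P′? (filter Q′? (allSubsets n′))) ∎
    where open ≡-Reasoning

  cliqueCount-pull : ∀ i → cliqueCount G i ≡ cliqueCount H i
  cliqueCount-pull i = count-pull _ _ _ _ (≗⇒≡-≐ isClique-pull) (≗⇒≡-≐ ∣pull∣)

  maxCliqueCount-pull : ∀ i → maxCliqueCount G i ≡ maxCliqueCount H i
  maxCliqueCount-pull i = count-pull _ _ _ _ (≗⇒≡-≐ isMaximalClique-pull) (≗⇒≡-≐ ∣pull∣)

-- Cliques of built graphs

module _ {m} (s : Vec Bool m) where

  Clique-tail : ∀ {b x} {S : Subset (suc m)} → Clique (build (b ∷ s)) (x ∷ S) → Clique (build s) S
  Clique-tail c u∈ v∈ u≢v = c (there u∈) (there v∈) (u≢v ∘ suc-injective)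

  Clique-skip : ∀ {b} {S : Subset (suc m)} → Clique (build s) S → Clique (build (b ∷ s)) (false ∷ S)
  Clique-skip c (there u∈) (there v∈) u≢v = c u∈ v∈ (u≢v ∘ cong suc)

  Clique-dominating : ∀ {S : Subset (suc m)} → Clique (build s) S → Clique (build (true ∷ s)) (true ∷ S)
  Clique-dominating c here       here       u≢v = ⊥-elim (u≢v refl)
  Clique-dominating c here       (there _)  _   = refl
  Clique-dominating c (there _)  here       _   = refl
  Clique-dominating c (there u∈) (there v∈) u≢v = c u∈ v∈ (u≢v ∘ cong suc)

  Clique-isolated⇔ : ∀ {S : Subset (suc m)} → Clique (build (false ∷ s)) (true ∷ S) ⇔ Empty S
  Clique-isolated⇔ = mk⇔ to from
    where
    to : ∀ {S} → Clique (build (false ∷ s)) (true ∷ S) → Empty S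
    to c (v , v∈) with () ← c here (there v∈) (λ ())
    from : ∀ {S} → Empty S → Clique (build (false ∷ s)) (true ∷ S)
    from e here       here       u≢v = ⊥-elim (u≢v refl)
    from e here       (there v∈) _   = ⊥-elim (e (_ , v∈))
    from e (there u∈) _          _   = ⊥-elim (e (_ , u∈))

  MaximalClique-dominating⇔ : ∀ {S} →
                              MaximalClique (build (true ∷ s)) (true ∷ S) ⇔ MaximalClique (build s) S
  MaximalClique-dominating⇔ = mk⇔
    (λ (c , maximal) → Clique-tail c , λ S′ c′ S⊆S′ →
       drop-∷-⊆ (maximal (true ∷ S′) (Clique-dominating c′) (s⊆s S⊆S′)))
    (λ (c , maximal) → Clique-dominating c , λ { (x ∷ S′) c′ ⊆x∷S′ →
       ∷⊆true∷ (maximal S′ (Clique-tail c′) (drop-∷-⊆ ⊆x∷S′)) })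
    where
    ∷⊆true∷ : ∀ {n x} {S S′ : Subset n} → S′ ⊆ S → x ∷ S′ ⊆ true ∷ S
    ∷⊆true∷ S′⊆S here       = here
    ∷⊆true∷ S′⊆S (there v∈) = there (S′⊆S v∈)

  ¬MaximalClique-omitting-dominating : ∀ {S} → ¬ MaximalClique (build (true ∷ s)) (false ∷ S)
  ¬MaximalClique-omitting-dominating {S} (c , maximal)
    with () ← maximal (true ∷ S) (Clique-dominating (Clique-tail c)) (λ { (there v∈) → there v∈ }) here

  MaximalClique-isolated⇔ : ∀ {S} → MaximalClique (build (false ∷ s)) (true ∷ S) ⇔ Empty S
  MaximalClique-isolated⇔ = mk⇔ (Equivalence.to Clique-isolated⇔ ∘ proj₁) λ e →
    Equivalence.from Clique-isolated⇔ e , λ { (x ∷ S′) c′ ⊆x∷S′ → only-new c′ (⊆x∷S′ here) }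
    where
    only-new : ∀ {x S S′} → Clique (build (false ∷ s)) (x ∷ S′) → zero ∈ x ∷ S′ → x ∷ S′ ⊆ true ∷ S
    only-new c′ here here       = here
    only-new c′ here (there v∈) = ⊥-elim (Equivalence.to Clique-isolated⇔ c′ (_ , v∈))

  MaximalClique-skip⇔ : ∀ {S} →
                        MaximalClique (build (false ∷ s)) (false ∷ S) ⇔ MaximalClique (build s) S
  MaximalClique-skip⇔ {S} = mk⇔
    (λ (c , maximal) → Clique-tail c , λ S′ c′ S⊆S′ →
       drop-∷-⊆ (maximal (false ∷ S′) (Clique-skip c′) (s⊆s S⊆S′)))
    (λ max@(c , maximal) → Clique-skip c , λ { (x ∷ S′) c′ ⊆x∷S′ →
       ∷⊆false∷ max c′ (drop-∷-⊆ ⊆x∷S′) (maximal S′ (Clique-tail c′) (drop-∷-⊆ ⊆x∷S′)) })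
    where
    ∷⊆false∷ : ∀ {x S′} → MaximalClique (build s) S → Clique (build (false ∷ s)) (x ∷ S′) →
               S ⊆ S′ → S′ ⊆ S → x ∷ S′ ⊆ false ∷ S
    ∷⊆false∷ {false} _   _  _    S′⊆S (there v∈) = there (S′⊆S v∈)
    ∷⊆false∷ {true}  max c′ S⊆S′ _    _
      with v , v∈S ← MaximalClique-nonempty {G = build s} max =
      ⊥-elim (Equivalence.to Clique-isolated⇔ c′ (v , S⊆S′ v∈S))

-- Counting cliques of built graphs

countOfSize : ∀ {n} → (Subset n → Bool) → ℕ → ℕ
countOfSize {n} p i = length (filter (λ S → p S ≟ᵇ true) (filter (λ S → ∣ S ∣ ≟ℕ i) (allSubsets n)))

countOfSize-cong : ∀ {n} {p q : Subset n → Bool} → (∀ S → p S ≡ q S) →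
                   ∀ i → countOfSize p i ≡ countOfSize q i
countOfSize-cong {n} p≗q i =
  cong length (filter-≐ _ _ (≗⇒≡-≐ p≗q) (filter (λ S → ∣ S ∣ ≟ℕ i) (allSubsets n)))

countOfSize-none : ∀ {n} {p : Subset n → Bool} → (∀ S → p S ≡ false) → ∀ i → countOfSize p i ≡ 0
countOfSize-none {n} {p} p-false i =
  cong length (filter-none (λ S → p S ≟ᵇ true) {xs = filter (λ S → ∣ S ∣ ≟ℕ i) (allSubsets n)}
                           (All.tabulate λ {S} _ e → case trans (≡.sym (p-false S)) e of λ ()))

countOfSize-cons : ∀ {n} (p : Subset (suc n) → Bool) i →
  countOfSize p i ≡
  length (filter (λ S → p (true ∷ S) ≟ᵇ true) (filter (λ S → suc ∣ S ∣ ≟ℕ i) (allSubsets n))) +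
  countOfSize (p ∘ (false ∷_)) i
countOfSize-cons {n} p i = begin
  countOfSize p i
    ≡⟨ cong (length ∘ filter P?) (filter-++ Q? (map (true ∷_) A) (map (false ∷_) A)) ⟩
  length (filter P? (filter Q? (map (true ∷_) A) ++ filter Q? (map (false ∷_) A)))
    ≡⟨ cong length (filter-++ P? (filter Q? (map (true ∷_) A)) (filter Q? (map (false ∷_) A))) ⟩
  length (filter P? (filter Q? (map (true ∷_) A)) ++ filter P? (filter Q? (map (false ∷_) A)))
    ≡⟨ length-++ (filter P? (filter Q? (map (true ∷_) A))) ⟩
  length (filter P? (filter Q? (map (true ∷_) A))) + length (filter P? (filter Q? (map (false ∷_) A)))
    ≡⟨ cong₂ _+_ (length-filter²-map P? Q? (true ∷_) A) (length-filter²-map P? Q? (false ∷_) A) ⟩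
  length (filter (λ S → p (true ∷ S) ≟ᵇ true) (filter (λ S → suc ∣ S ∣ ≟ℕ i) A)) +
  countOfSize (p ∘ (false ∷_)) i ∎
  where
  open ≡-Reasoning
  A = allSubsets n
  P? = λ (S : Subset (suc n)) → p S ≟ᵇ true
  Q? = λ (S : Subset (suc n)) → ∣ S ∣ ≟ℕ i

countOfSize-suc : ∀ {n} (p : Subset (suc n) → Bool) i →
  countOfSize p (suc i) ≡ countOfSize (p ∘ (true ∷_)) i + countOfSize (p ∘ (false ∷_)) (suc i)
countOfSize-suc {n} p i = trans (countOfSize-cons p (suc i))
  (cong (λ l → length (filter (λ S → p (true ∷ S) ≟ᵇ true) l) + countOfSize (p ∘ (false ∷_)) (suc i))
        (filter-≐ _ _ (ℕₚ.suc-injective , cong suc) (allSubsets n)))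

countOfSize-zero : ∀ {n} (p : Subset (suc n) → Bool) → countOfSize p 0 ≡ countOfSize (p ∘ (false ∷_)) 0
countOfSize-zero {n} p = trans (countOfSize-cons p 0)
  (cong (λ l → length (filter (λ S → p (true ∷ S) ≟ᵇ true) l) + countOfSize (p ∘ (false ∷_)) 0)
        (filter-none (λ S → suc ∣ S ∣ ≟ℕ 0) {xs = allSubsets n} (All.tabulate λ _ ())))

oneIfZero : ℕ → ℕ
oneIfZero zero    = 1
oneIfZero (suc _) = 0

countOfSize-emptyOnly : ∀ {n} {p : Subset n → Bool} → (∀ S → p S ≡ true ⇔ Empty S) →
                        ∀ i → countOfSize p i ≡ oneIfZero i
countOfSize-emptyOnly {zero} {p} p⇔ zero =
  cong length (filter-accept (λ S → p S ≟ᵇ true) {xs = []} (Equivalence.from (p⇔ []) λ { (() , _) }))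
countOfSize-emptyOnly {zero} p⇔ (suc i) = refl
countOfSize-emptyOnly {suc n} {p} p⇔ zero = trans (countOfSize-zero p)
  (countOfSize-emptyOnly (λ S → ⇔-trans (p⇔ (false ∷ S)) Empty-∷⇔) zero)
countOfSize-emptyOnly {suc n} {p} p⇔ (suc i) = trans (countOfSize-suc p i)
  (cong₂ _+_ (countOfSize-none (λ S → ¬-not (λ e → Equivalence.to (p⇔ (true ∷ S)) e (zero , here))) i)
             (countOfSize-emptyOnly (λ S → ⇔-trans (p⇔ (false ∷ S)) Empty-∷⇔) (suc i)))

module _ {m} (s : Vec Bool m) where

  isClique-skip : ∀ b S → isClique (build (b ∷ s)) (false ∷ S) ≡ isClique (build s) S
  isClique-skip b S =
    reflects-⇔⇒≡ (isClique⇔Clique (build (b ∷ s)) (false ∷ S)) (isClique⇔Clique (build s) S)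
                 (mk⇔ (Clique-tail s) (Clique-skip s))

  isClique-dominating : ∀ S → isClique (build (true ∷ s)) (true ∷ S) ≡ isClique (build s) S
  isClique-dominating S =
    reflects-⇔⇒≡ (isClique⇔Clique (build (true ∷ s)) (true ∷ S)) (isClique⇔Clique (build s) S)
                 (mk⇔ (Clique-tail s) (Clique-dominating s))

  isClique-isolated⇔ : ∀ S → isClique (build (false ∷ s)) (true ∷ S) ≡ true ⇔ Empty S
  isClique-isolated⇔ S = ⇔-trans (isClique⇔Clique (build (false ∷ s)) (true ∷ S)) (Clique-isolated⇔ s)

  isMaximalClique-skip : ∀ S → isMaximalClique (build (false ∷ s)) (false ∷ S) ≡ isMaximalClique (build s) S
  isMaximalClique-skip S =
    reflects-⇔⇒≡ (isMaximalClique⇔MaximalClique (build (false ∷ s)) (false ∷ S))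
                 (isMaximalClique⇔MaximalClique (build s) S) (MaximalClique-skip⇔ s)

  isMaximalClique-dominating : ∀ S → isMaximalClique (build (true ∷ s)) (true ∷ S) ≡ isMaximalClique (build s) S
  isMaximalClique-dominating S =
    reflects-⇔⇒≡ (isMaximalClique⇔MaximalClique (build (true ∷ s)) (true ∷ S))
                 (isMaximalClique⇔MaximalClique (build s) S) (MaximalClique-dominating⇔ s)

  isMaximalClique-omitting-dominating : ∀ S → isMaximalClique (build (true ∷ s)) (false ∷ S) ≡ false
  isMaximalClique-omitting-dominating S = ¬-not (¬MaximalClique-omitting-dominating s ∘
    Equivalence.to (isMaximalClique⇔MaximalClique (build (true ∷ s)) (false ∷ S)))

  isMaximalClique-isolated⇔ : ∀ S → isMaximalClique (build (false ∷ s)) (true ∷ S) ≡ true ⇔ Empty S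
  isMaximalClique-isolated⇔ S =
    ⇔-trans (isMaximalClique⇔MaximalClique (build (false ∷ s)) (true ∷ S)) (MaximalClique-isolated⇔ s)

cliqueSeq : ∀ {m} → Vec Bool m → ℕ → ℕ
cliqueSeq []          zero          = 1
cliqueSeq []          (suc zero)    = 1
cliqueSeq []          (suc (suc _)) = 0
cliqueSeq (_ ∷ s)     zero          = cliqueSeq s zero
cliqueSeq (true ∷ s)  (suc i)       = cliqueSeq s i + cliqueSeq s (suc i)
cliqueSeq (false ∷ s) (suc i)       = oneIfZero i + cliqueSeq s (suc i)

maximalCliqueSeq : ∀ {m} → Vec Bool m → ℕ → ℕ
maximalCliqueSeq []          zero          = 0
maximalCliqueSeq []          (suc zero)    = 1
maximalCliqueSeq []          (suc (suc _)) = 0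
maximalCliqueSeq (true ∷ s)  zero          = 0
maximalCliqueSeq (true ∷ s)  (suc i)       = maximalCliqueSeq s i
maximalCliqueSeq (false ∷ s) zero          = maximalCliqueSeq s zero
maximalCliqueSeq (false ∷ s) (suc i)       = oneIfZero i + maximalCliqueSeq s (suc i)

cliqueCount-build : ∀ {m} (s : Vec Bool m) i → cliqueCount (build s) i ≡ cliqueSeq s i
cliqueCount-build []          zero          = refl
cliqueCount-build []          (suc zero)    = refl
cliqueCount-build []          (suc (suc i)) = refl
cliqueCount-build (b ∷ s)     zero          =
  trans (countOfSize-zero (isClique (build (b ∷ s))))
        (trans (countOfSize-cong (isClique-skip s b) 0) (cliqueCount-build s 0))
cliqueCount-build (true ∷ s)  (suc i)       =
  trans (countOfSize-suc (isClique (build (true ∷ s))) i)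
        (cong₂ _+_ (trans (countOfSize-cong (isClique-dominating s) i) (cliqueCount-build s i))
                   (trans (countOfSize-cong (isClique-skip s true) (suc i)) (cliqueCount-build s (suc i))))
cliqueCount-build (false ∷ s) (suc i)       =
  trans (countOfSize-suc (isClique (build (false ∷ s))) i)
        (cong₂ _+_ (countOfSize-emptyOnly (isClique-isolated⇔ s) i)
                   (trans (countOfSize-cong (isClique-skip s false) (suc i)) (cliqueCount-build s (suc i))))

maxCliqueCount-build : ∀ {m} (s : Vec Bool m) i → maxCliqueCount (build s) i ≡ maximalCliqueSeq s i
maxCliqueCount-build []          zero          = refl
maxCliqueCount-build []          (suc zero)    = refl
maxCliqueCount-build []          (suc (suc i)) = refl
maxCliqueCount-build (true ∷ s)  zero          =
  trans (countOfSize-zero (isMaximalClique (build (true ∷ s))))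
        (countOfSize-none (isMaximalClique-omitting-dominating s) 0)
maxCliqueCount-build (true ∷ s)  (suc i)       =
  trans (countOfSize-suc (isMaximalClique (build (true ∷ s))) i)
        (trans (cong₂ _+_ (trans (countOfSize-cong (isMaximalClique-dominating s) i) (maxCliqueCount-build s i))
                          (countOfSize-none (isMaximalClique-omitting-dominating s) (suc i)))
               (ℕₚ.+-identityʳ _))
maxCliqueCount-build (false ∷ s) zero          =
  trans (countOfSize-zero (isMaximalClique (build (false ∷ s))))
        (trans (countOfSize-cong (isMaximalClique-skip s) 0) (maxCliqueCount-build s 0))
maxCliqueCount-build (false ∷ s) (suc i)       =
  trans (countOfSize-suc (isMaximalClique (build (false ∷ s))) i)
        (cong₂ _+_ (countOfSize-emptyOnly (isMaximalClique-isolated⇔ s) i)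
                   (trans (countOfSize-cong (isMaximalClique-skip s) (suc i)) (maxCliqueCount-build s (suc i))))

dominatingSteps : ∀ {m} → Vec Bool m → ℕ
dominatingSteps []          = 0
dominatingSteps (true ∷ s)  = suc (dominatingSteps s)
dominatingSteps (false ∷ s) = dominatingSteps s

leadingDominatingSteps : ∀ {m} → Vec Bool m → ℕ
leadingDominatingSteps []          = 0
leadingDominatingSteps (true ∷ s)  = suc (leadingDominatingSteps s)
leadingDominatingSteps (false ∷ s) = 0

bSeq : ∀ {m} → Vec Bool m → ℕ → ℕ
bSeq []          zero          = 0
bSeq []          (suc zero)    = 1
bSeq []          (suc (suc _)) = 0
bSeq (true ∷ s)  zero          = 0
bSeq (true ∷ s)  (suc zero)    = 1
bSeq (true ∷ s)  (suc (suc i)) = bSeq s (suc i)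
bSeq (false ∷ s) zero          = 0
bSeq (false ∷ s) (suc i)       = oneIfZero i + bSeq s (suc i)

leading≤dominating : ∀ {m} (s : Vec Bool m) → leadingDominatingSteps s ≤ dominatingSteps s
leading≤dominating []          = z≤n
leading≤dominating (true ∷ s)  = s≤s (leading≤dominating s)
leading≤dominating (false ∷ s) = z≤n

cliqueSeq-zero : ∀ {m} (s : Vec Bool m) → cliqueSeq s 0 ≡ 1
cliqueSeq-zero []      = refl
cliqueSeq-zero (_ ∷ s) = cliqueSeq-zero s

cliqueSeq-vanishes : ∀ {m} (s : Vec Bool m) i → suc (dominatingSteps s) < i → cliqueSeq s i ≡ 0
cliqueSeq-vanishes []          (suc zero)    (s≤s ())
cliqueSeq-vanishes []          (suc (suc i)) _         = refl
cliqueSeq-vanishes (true ∷ s)  (suc i)       (s≤s lt)  =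
  cong₂ _+_ (cliqueSeq-vanishes s i lt) (cliqueSeq-vanishes s (suc i) (ℕₚ.m≤n⇒m≤1+n lt))
cliqueSeq-vanishes (false ∷ s) (suc zero)    (s≤s ())
cliqueSeq-vanishes (false ∷ s) (suc (suc i)) lt        = cliqueSeq-vanishes s (suc (suc i)) lt

maximalCliqueSeq-zero : ∀ {m} (s : Vec Bool m) → maximalCliqueSeq s 0 ≡ 0
maximalCliqueSeq-zero []          = refl
maximalCliqueSeq-zero (true ∷ s)  = refl
maximalCliqueSeq-zero (false ∷ s) = maximalCliqueSeq-zero s

maximalCliqueSeq-leading : ∀ {m} (s : Vec Bool m) i → suc i ≤ leadingDominatingSteps s →
                           maximalCliqueSeq s (suc i) ≡ 0
maximalCliqueSeq-leading (true ∷ s) zero    _        = maximalCliqueSeq-zero s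
maximalCliqueSeq-leading (true ∷ s) (suc i) (s≤s le) = maximalCliqueSeq-leading s i le

bSeq-below-top : ∀ {m} (s : Vec Bool m) i → suc i ≤ dominatingSteps s →
                 bSeq s (suc i) ≡ suc (maximalCliqueSeq s (suc i))
bSeq-below-top (true ∷ s)  zero    _        = cong suc (≡.sym (maximalCliqueSeq-zero s))
bSeq-below-top (true ∷ s)  (suc i) (s≤s le) = bSeq-below-top s i le
bSeq-below-top (false ∷ s) i       le       =
  trans (cong (λ z → oneIfZero i + z) (bSeq-below-top s i le)) (ℕₚ.+-suc (oneIfZero i) _)

bSeq-top : ∀ {m} (s : Vec Bool m) →
           bSeq s (suc (dominatingSteps s)) ≡ maximalCliqueSeq s (suc (dominatingSteps s))
bSeq-top []          = refl
bSeq-top (true ∷ s)  = bSeq-top s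
bSeq-top (false ∷ s) = cong (λ z → oneIfZero (dominatingSteps s) + z) (bSeq-top s)

-- Integer polynomials

-- Coefficients are indexed from 1, as in the b-vector; f 0 is never used.
poly : (ℕ → ℤ) → ℕ → ℤ → ℤ
poly f d y = sumTo d (λ i → f i ℤ.* y ℤ.^ (i ∸ 1))

poly-horner : ∀ f d y → poly f (suc d) y ≡ f 1 ℤ.+ y ℤ.* poly (f ∘ suc) d y
poly-horner f zero    y = ring (f 1) y
  where
  ring : ∀ a y → + 0 ℤ.+ a ℤ.* + 1 ≡ a ℤ.+ y ℤ.* + 0
  ring = solve-∀
poly-horner f (suc d) y = begin
  poly f (suc d) y ℤ.+ f (2 + d) ℤ.* (y ℤ.* y ℤ.^ d)
    ≡⟨ cong (ℤ._+ f (2 + d) ℤ.* (y ℤ.* y ℤ.^ d)) (poly-horner f d y) ⟩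
  f 1 ℤ.+ y ℤ.* poly (f ∘ suc) d y ℤ.+ f (2 + d) ℤ.* (y ℤ.* y ℤ.^ d)
    ≡⟨ ring (f 1) y (poly (f ∘ suc) d y) (f (2 + d)) (y ℤ.^ d) ⟩
  f 1 ℤ.+ y ℤ.* (poly (f ∘ suc) d y ℤ.+ f (2 + d) ℤ.* y ℤ.^ d) ∎
  where
  open ≡-Reasoning
  ring : ∀ a y e b p → a ℤ.+ y ℤ.* e ℤ.+ b ℤ.* (y ℤ.* p) ≡ a ℤ.+ y ℤ.* (e ℤ.+ b ℤ.* p)
  ring = solve-∀

poly-cong : ∀ f g d y → (∀ k → f (suc k) ≡ g (suc k)) → poly f d y ≡ poly g d y
poly-cong f g zero    y f≗g = refl
poly-cong f g (suc d) y f≗g = cong₂ ℤ._+_ (poly-cong f g d y f≗g) (cong (ℤ._* y ℤ.^ d) (f≗g d))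

poly-+ : ∀ f g d y → poly (λ i → f i ℤ.+ g i) d y ≡ poly f d y ℤ.+ poly g d y
poly-+ f g zero    y = refl
poly-+ f g (suc d) y = trans (cong (ℤ._+ (f (suc d) ℤ.+ g (suc d)) ℤ.* y ℤ.^ d) (poly-+ f g d y))
                             (ring (poly f d y) (poly g d y) (f (suc d)) (g (suc d)) (y ℤ.^ d))
  where
  ring : ∀ a b c e p → a ℤ.+ b ℤ.+ (c ℤ.+ e) ℤ.* p ≡ a ℤ.+ c ℤ.* p ℤ.+ (b ℤ.+ e ℤ.* p)
  ring = solve-∀

poly-neg : ∀ f d y → poly (λ i → ℤ.- f i) d y ≡ ℤ.- poly f d y
poly-neg f zero    y = refl
poly-neg f (suc d) y = trans (cong (ℤ._+ (ℤ.- f (suc d)) ℤ.* y ℤ.^ d) (poly-neg f d y))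
                             (ring (poly f d y) (f (suc d)) (y ℤ.^ d))
  where
  ring : ∀ a c p → ℤ.- a ℤ.+ (ℤ.- c) ℤ.* p ≡ ℤ.- (a ℤ.+ c ℤ.* p)
  ring = solve-∀

poly-one : ∀ d y → poly (λ i → + oneIfZero (i ∸ 1)) (suc d) y ≡ + 1
poly-one zero    y = refl
poly-one (suc d) y = trans (cong (ℤ._+ + 0 ℤ.* (y ℤ.* y ℤ.^ d)) (poly-one d y)) (ring (y ℤ.* y ℤ.^ d))
  where
  ring : ∀ p → + 1 ℤ.+ + 0 ℤ.* p ≡ + 1
  ring = solve-∀

poly-drop-top : ∀ f d y → f (suc d) ≡ + 0 → poly f (suc d) y ≡ poly f d y
poly-drop-top f d y f-top≡0 =
  trans (cong (λ c → poly f d y ℤ.+ c ℤ.* y ℤ.^ d) f-top≡0) (ring (poly f d y) (y ℤ.^ d))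
  where
  ring : ∀ a p → a ℤ.+ + 0 ℤ.* p ≡ a
  ring = solve-∀

n≡[1+n]*q⇒n≡0 : ∀ n q → n ≡ suc n ℕ.* q → n ≡ 0
n≡[1+n]*q⇒n≡0 n zero    n≡ = trans n≡ (ℕₚ.*-zeroʳ (suc n))
n≡[1+n]*q⇒n≡0 n (suc q) n≡ =
  ⊥-elim (ℕₚ.n≮n n (ℕₚ.≤-trans (ℕₚ.m≤m*n (suc n) (suc q)) (ℕₚ.≤-reflexive (≡.sym n≡))))

module _ (e : ℕ → ℤ) (d : ℕ) (vanishes : ∀ y → y ≢ + 0 → poly e (suc d) y ≡ + 0) where

  private
    horner-vanishes : ∀ y → y ≢ + 0 → e 1 ℤ.+ y ℤ.* poly (e ∘ suc) d y ≡ + 0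
    horner-vanishes y y≢0 = trans (≡.sym (poly-horner e d y)) (vanishes y y≢0)

  -- Evaluating at y = 1 + ∣e 1∣ makes e 1 a multiple of a number exceeding its absolute value.
  first-coefficient-zero : e 1 ≡ + 0
  first-coefficient-zero = ℤₚ.∣i∣≡0⇒i≡0 (n≡[1+n]*q⇒n≡0 ∣e₁∣ ℤ.∣ q ∣ (begin
    ∣e₁∣                  ≡⟨ cong ℤ.∣_∣ e₁≡-yq ⟩
    ℤ.∣ ℤ.- (y ℤ.* q) ∣   ≡⟨ ℤₚ.∣-i∣≡∣i∣ (y ℤ.* q) ⟩
    ℤ.∣ y ℤ.* q ∣         ≡⟨ ℤₚ.abs-* y q ⟩
    suc ∣e₁∣ ℕ.* ℤ.∣ q ∣  ∎))
    where
    open ≡-Reasoning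
    ∣e₁∣ = ℤ.∣ e 1 ∣
    y = + suc ∣e₁∣
    q = poly (e ∘ suc) d y
    e₁≡-yq : e 1 ≡ ℤ.- (y ℤ.* q)
    e₁≡-yq = ℤₚ.i-j≡0⇒i≡j (e 1) _
      (trans (cong (ℤ._+_ (e 1)) (ℤₚ.neg-involutive (y ℤ.* q))) (horner-vanishes y (λ ())))

  tail-vanishes : ∀ y → y ≢ + 0 → poly (e ∘ suc) d y ≡ + 0
  tail-vanishes y y≢0 with ℤₚ.i*j≡0⇒i≡0∨j≡0 y (begin
    y ℤ.* poly (e ∘ suc) d y            ≡˘⟨ ℤₚ.+-identityˡ _ ⟩
    + 0 ℤ.+ y ℤ.* poly (e ∘ suc) d y    ≡˘⟨ cong (ℤ._+ y ℤ.* poly (e ∘ suc) d y) first-coefficient-zero ⟩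
    e 1 ℤ.+ y ℤ.* poly (e ∘ suc) d y    ≡⟨ horner-vanishes y y≢0 ⟩
    + 0                                 ∎)
    where open ≡-Reasoning
  ... | inj₁ y≡0 = ⊥-elim (y≢0 y≡0)
  ... | inj₂ q≡0 = q≡0

poly-vanishing⇒coefficients-zero : ∀ d e → (∀ y → y ≢ + 0 → poly e d y ≡ + 0) →
                                   ∀ i → 1 ≤ i → i ≤ d → e i ≡ + 0
poly-vanishing⇒coefficients-zero zero    e vanishes (suc i)       _ ()
poly-vanishing⇒coefficients-zero (suc d) e vanishes (suc zero)    _ _        = first-coefficient-zero e d vanishes
poly-vanishing⇒coefficients-zero (suc d) e vanishes (suc (suc i)) _ (s≤s le) =
  poly-vanishing⇒coefficients-zero d (e ∘ suc) (tail-vanishes e d vanishes) (suc i) (s≤s z≤n) le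

-- The b-polynomial identity for built graphs

cliquePoly : ∀ {m} → Vec Bool m → ℤ → ℤ
cliquePoly s = poly (λ i → + cliqueSeq s i) (suc (dominatingSteps s))

bPoly : ∀ {m} → Vec Bool m → ℤ → ℤ
bPoly s = poly (λ i → + bSeq s i) (suc (dominatingSteps s))

poly-one+ : ∀ (f : ℕ → ℕ) d y →
            poly (λ i → + (oneIfZero (i ∸ 1) + f i)) (suc d) y ≡ + 1 ℤ.+ poly (λ i → + f i) (suc d) y
poly-one+ f d y = begin
  poly (λ i → + (oneIfZero (i ∸ 1) + f i)) (suc d) y
    ≡⟨ poly-cong (λ i → + (oneIfZero (i ∸ 1) + f i)) (λ i → + oneIfZero (i ∸ 1) ℤ.+ + f i) (suc d) y
                 (λ k → ℤₚ.pos-+ (oneIfZero k) (f (suc k))) ⟩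
  poly (λ i → + oneIfZero (i ∸ 1) ℤ.+ + f i) (suc d) y
    ≡⟨ poly-+ (λ i → + oneIfZero (i ∸ 1)) (λ i → + f i) (suc d) y ⟩
  poly (λ i → + oneIfZero (i ∸ 1)) (suc d) y ℤ.+ poly (λ i → + f i) (suc d) y
    ≡⟨ cong (ℤ._+ poly (λ i → + f i) (suc d) y) (poly-one d y) ⟩
  + 1 ℤ.+ poly (λ i → + f i) (suc d) y ∎
  where open ≡-Reasoning

module _ {m} (s : Vec Bool m) where
  private
    D = dominatingSteps s
    γ = cliqueSeq s

  cliquePoly-isolated : ∀ x → cliquePoly (false ∷ s) x ≡ + 1 ℤ.+ cliquePoly s x
  cliquePoly-isolated x =
    trans (poly-cong (λ i → + cliqueSeq (false ∷ s) i) (λ i → + (oneIfZero (i ∸ 1) + γ i)) (suc D) x (λ _ → refl))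
          (poly-one+ γ D x)

  bPoly-isolated : ∀ y → bPoly (false ∷ s) y ≡ + 1 ℤ.+ bPoly s y
  bPoly-isolated y =
    trans (poly-cong (λ i → + bSeq (false ∷ s) i) (λ i → + (oneIfZero (i ∸ 1) + bSeq s i)) (suc D) y (λ _ → refl))
          (poly-one+ (bSeq s) D y)

  bPoly-dominating : ∀ y → bPoly (true ∷ s) y ≡ + 1 ℤ.+ y ℤ.* bPoly s y
  bPoly-dominating y = trans (poly-horner (λ i → + bSeq (true ∷ s) i) (suc D) y) (cong (λ p → + 1 ℤ.+ y ℤ.* p)
    (poly-cong (λ i → + bSeq (true ∷ s) (suc i)) (λ i → + bSeq s i) (suc D) y (λ _ → refl)))

  -- A clique of the new graph avoids the dominating vertex or is an old clique plus that vertex,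
  -- hence the factor x + 1.
  cliquePoly-dominating : ∀ x → cliquePoly (true ∷ s) x ≡ + 1 ℤ.+ (x ℤ.+ + 1) ℤ.* cliquePoly s x
  cliquePoly-dominating x = begin
    cliquePoly (true ∷ s) x
      ≡⟨ poly-horner (λ i → + cliqueSeq (true ∷ s) i) (suc D) x ⟩
    + (γ 0 + γ 1) ℤ.+ x ℤ.* poly (λ i → + (γ i + γ (suc i))) (suc D) x
      ≡⟨ cong₂ (λ a p → a ℤ.+ x ℤ.* p) first split ⟩
    + 1 ℤ.+ + γ 1 ℤ.+ x ℤ.* (cliquePoly s x ℤ.+ q)
      ≡⟨ cong (λ p → + 1 ℤ.+ + γ 1 ℤ.+ x ℤ.* (p ℤ.+ q)) (poly-horner (λ i → + γ i) D x) ⟩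
    + 1 ℤ.+ + γ 1 ℤ.+ x ℤ.* (+ γ 1 ℤ.+ x ℤ.* q ℤ.+ q)
      ≡⟨ ring x (+ γ 1) q ⟩
    + 1 ℤ.+ (x ℤ.+ + 1) ℤ.* (+ γ 1 ℤ.+ x ℤ.* q)
      ≡˘⟨ cong (λ p → + 1 ℤ.+ (x ℤ.+ + 1) ℤ.* p) (poly-horner (λ i → + γ i) D x) ⟩
    + 1 ℤ.+ (x ℤ.+ + 1) ℤ.* cliquePoly s x ∎
    where
    open ≡-Reasoning
    q = poly (λ i → + γ (suc i)) D x
    first : + (γ 0 + γ 1) ≡ + 1 ℤ.+ + γ 1
    first = trans (ℤₚ.pos-+ (γ 0) (γ 1)) (cong (λ c → + c ℤ.+ + γ 1) (cliqueSeq-zero s))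
    split : poly (λ i → + (γ i + γ (suc i))) (suc D) x ≡ cliquePoly s x ℤ.+ q
    split = begin
      poly (λ i → + (γ i + γ (suc i))) (suc D) x
        ≡⟨ poly-cong (λ i → + (γ i + γ (suc i))) (λ i → + γ i ℤ.+ + γ (suc i)) (suc D) x
                     (λ k → ℤₚ.pos-+ (γ (suc k)) (γ (2 + k))) ⟩
      poly (λ i → + γ i ℤ.+ + γ (suc i)) (suc D) x
        ≡⟨ poly-+ (λ i → + γ i) (λ i → + γ (suc i)) (suc D) x ⟩
      cliquePoly s x ℤ.+ poly (λ i → + γ (suc i)) (suc D) x
        ≡⟨ cong (ℤ._+_ (cliquePoly s x)) (poly-drop-top (λ i → + γ (suc i)) D x
                                        (cong +_ (cliqueSeq-vanishes s (2 + D) ℕₚ.≤-refl))) ⟩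
      cliquePoly s x ℤ.+ q ∎
    ring : ∀ x c q → + 1 ℤ.+ c ℤ.+ x ℤ.* (c ℤ.+ x ℤ.* q ℤ.+ q) ≡
                     + 1 ℤ.+ (x ℤ.+ + 1) ℤ.* (c ℤ.+ x ℤ.* q)
    ring = solve-∀

bPoly-shift : ∀ {m} (s : Vec Bool m) x → bPoly s (x ℤ.+ + 1) ≡ cliquePoly s x
bPoly-shift []          x = refl
bPoly-shift (true ∷ s)  x = begin
  bPoly (true ∷ s) (x ℤ.+ + 1)                  ≡⟨ bPoly-dominating s (x ℤ.+ + 1) ⟩
  + 1 ℤ.+ (x ℤ.+ + 1) ℤ.* bPoly s (x ℤ.+ + 1)   ≡⟨ cong (λ p → + 1 ℤ.+ (x ℤ.+ + 1) ℤ.* p) (bPoly-shift s x) ⟩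
  + 1 ℤ.+ (x ℤ.+ + 1) ℤ.* cliquePoly s x        ≡˘⟨ cliquePoly-dominating s x ⟩
  cliquePoly (true ∷ s) x                       ∎
  where open ≡-Reasoning
bPoly-shift (false ∷ s) x = begin
  bPoly (false ∷ s) (x ℤ.+ + 1)      ≡⟨ bPoly-isolated s (x ℤ.+ + 1) ⟩
  + 1 ℤ.+ bPoly s (x ℤ.+ + 1)        ≡⟨ cong (ℤ._+_ (+ 1)) (bPoly-shift s x) ⟩
  + 1 ℤ.+ cliquePoly s x             ≡˘⟨ cliquePoly-isolated s x ⟩
  cliquePoly (false ∷ s) x           ∎
  where open ≡-Reasoning

-- Large cliques of built graphs

maximumClique : ∀ {m} → Vec Bool m → Subset (suc m)
maximumClique []      = true ∷ []
maximumClique (b ∷ s) = b ∷ maximumClique s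

∣maximumClique∣ : ∀ {m} (s : Vec Bool m) → ∣ maximumClique s ∣ ≡ suc (dominatingSteps s)
∣maximumClique∣ []          = refl
∣maximumClique∣ (true ∷ s)  = cong suc (∣maximumClique∣ s)
∣maximumClique∣ (false ∷ s) = ∣maximumClique∣ s

maximumClique-maximal : ∀ {m} (s : Vec Bool m) → MaximalClique (build s) (maximumClique s)
maximumClique-maximal []          = Clique-⁅⁆ (build []) zero , λ { _ _ _ here → here }
maximumClique-maximal (true ∷ s)  = Equivalence.from (MaximalClique-dominating⇔ s) (maximumClique-maximal s)
maximumClique-maximal (false ∷ s) = Equivalence.from (MaximalClique-skip⇔ s) (maximumClique-maximal s)

recentDominating : ∀ {m} → ℕ → Vec Bool m → Subset (suc m)
recentDominating zero    s           = ∅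
recentDominating (suc i) []          = ∅
recentDominating (suc i) (true ∷ s)  = true ∷ recentDominating i s
recentDominating (suc i) (false ∷ s) = false ∷ recentDominating (suc i) s

recentDominating-clique : ∀ {m} i (s : Vec Bool m) → Clique (build s) (recentDominating i s)
recentDominating-clique zero    s           = λ u∈∅ → ⊥-elim (∉⊥ u∈∅)
recentDominating-clique (suc i) []          = λ u∈∅ → ⊥-elim (∉⊥ u∈∅)
recentDominating-clique (suc i) (true ∷ s)  = Clique-dominating s (recentDominating-clique i s)
recentDominating-clique (suc i) (false ∷ s) = Clique-skip s (recentDominating-clique (suc i) s)

∣recentDominating∣ : ∀ {m} i (s : Vec Bool m) → i ≤ dominatingSteps s → ∣ recentDominating i s ∣ ≡ i
∣recentDominating∣ {m} zero s           _        = ∣⊥∣≡0 (suc m)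
∣recentDominating∣ (suc i) (true ∷ s)  (s≤s le) = cong suc (∣recentDominating∣ i s le)
∣recentDominating∣ (suc i) (false ∷ s) le       = ∣recentDominating∣ (suc i) s le

recentDominating-⊆ : ∀ {m} i (s : Vec Bool m) {C} → MaximalClique (build s) C → i < ∣ C ∣ →
                     recentDominating i s ⊆ C
recentDominating-⊆ zero    s           {C}         _   _        = ⊥⊆
recentDominating-⊆ (suc i) []          {C}         _   lt       =
  ⊥-elim (ℕₚ.<⇒≱ lt (ℕₚ.≤-trans (∣p∣≤n C) (s≤s z≤n)))
recentDominating-⊆ (suc i) (true ∷ s)  {false ∷ C} max _        = ⊥-elim (¬MaximalClique-omitting-dominating s max)
recentDominating-⊆ (suc i) (true ∷ s)  {true ∷ C}  max (s≤s lt) =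
  s⊆s (recentDominating-⊆ i s (Equivalence.to (MaximalClique-dominating⇔ s) max) lt)
recentDominating-⊆ (suc i) (false ∷ s) {true ∷ C}  max (s≤s lt)
  with () ← subst (suc i ≤_) (Empty⇒∣p∣≡0 (Equivalence.to (MaximalClique-isolated⇔ s) max)) lt
recentDominating-⊆ (suc i) (false ∷ s) {false ∷ C} max lt       =
  s⊆s (recentDominating-⊆ (suc i) s (Equivalence.to (MaximalClique-skip⇔ s) max) lt)

∣clique∣≤ : ∀ {m} (s : Vec Bool m) {S} → Clique (build s) S → ∣ S ∣ ≤ suc (dominatingSteps s)
∣clique∣≤ []          {S}         _ = ∣p∣≤n S
∣clique∣≤ (true ∷ s)  {true ∷ S}  c = s≤s (∣clique∣≤ s (Clique-tail s c))
∣clique∣≤ (true ∷ s)  {false ∷ S} c = ℕₚ.m≤n⇒m≤1+n (∣clique∣≤ s (Clique-tail s c))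
∣clique∣≤ (false ∷ s) {true ∷ S}  c =
  s≤s (subst (_≤ _) (≡.sym (Empty⇒∣p∣≡0 (Equivalence.to (Clique-isolated⇔ s) c))) z≤n)
∣clique∣≤ (false ∷ s) {false ∷ S} c = ∣clique∣≤ s (Clique-tail s c)

-- Vertex cuts and components of built graphs

leadingDominating : ∀ {m} → Vec Bool m → Subset (suc m)
leadingDominating []          = ∅
leadingDominating (true ∷ s)  = true ∷ leadingDominating s
leadingDominating (false ∷ s) = ∅

∣leadingDominating∣ : ∀ {m} (s : Vec Bool m) → ∣ leadingDominating s ∣ ≡ leadingDominatingSteps s
∣leadingDominating∣ []                  = refl
∣leadingDominating∣ (true ∷ s)          = cong suc (∣leadingDominating∣ s)
∣leadingDominating∣ {suc m} (false ∷ s) = ∣⊥∣≡0 (2 + m)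

leadingDominating-universal : ∀ {m} (s : Vec Bool m) {v} → v ∈ leadingDominating s → Universal (build s) v
leadingDominating-universal []          v∈ = ⊥-elim (∉⊥ v∈)
leadingDominating-universal (false ∷ s) v∈ = ⊥-elim (∉⊥ v∈)
leadingDominating-universal (true ∷ s) {zero}  _          {zero}  v≢w = ⊥-elim (v≢w refl)
leadingDominating-universal (true ∷ s) {zero}  _          {suc w} _   = refl
leadingDominating-universal (true ∷ s) {suc v} _          {zero}  _   = refl
leadingDominating-universal (true ∷ s) {suc v} (there v∈) {suc w} v≢w =
  leadingDominating-universal s v∈ (v≢w ∘ cong suc)

-- Locates the most recently added isolated vertex: only dominating steps come after it.
data LatestIsolated : ∀ {m} → Vec Bool m → Set where
  isolated-head   : ∀ {m} {s : Vec Bool m} → LatestIsolated (false ∷ s)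
  dominating-head : ∀ {m} {s : Vec Bool m} → LatestIsolated s → LatestIsolated (true ∷ s)

latestIsolated⊎complete : ∀ {m} (s : Vec Bool m) → LatestIsolated s ⊎ IsComplete (build s)
latestIsolated⊎complete []          = inj₂ λ { zero zero u≢v → ⊥-elim (u≢v refl) }
latestIsolated⊎complete (false ∷ s) = inj₁ isolated-head
latestIsolated⊎complete (true ∷ s)  with latestIsolated⊎complete s
... | inj₁ latest   = inj₁ (dominating-head latest)
... | inj₂ complete = inj₂ λ where
  zero    zero    u≢v → ⊥-elim (u≢v refl)
  zero    (suc v) _   → refl
  (suc u) zero    _   → refl
  (suc u) (suc v) u≢v → complete u v (u≢v ∘ cong suc)

latestIsolatedVertex : ∀ {m} {s : Vec Bool m} → LatestIsolated s → Fin (suc m)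
latestIsolatedVertex isolated-head            = zero
latestIsolatedVertex (dominating-head latest) = suc (latestIsolatedVertex latest)

precedingVertex : ∀ {m} {s : Vec Bool m} → LatestIsolated s → Fin (suc m)
precedingVertex isolated-head            = suc zero
precedingVertex (dominating-head latest) = suc (precedingVertex latest)

latestIsolatedVertex-∉ : ∀ {m} {s : Vec Bool m} (latest : LatestIsolated s) →
                         latestIsolatedVertex latest ∉ leadingDominating s
latestIsolatedVertex-∉ isolated-head            = ∉⊥
latestIsolatedVertex-∉ (dominating-head latest) = latestIsolatedVertex-∉ latest ∘ drop-there

precedingVertex-∉ : ∀ {m} {s : Vec Bool m} (latest : LatestIsolated s) →
                    precedingVertex latest ∉ leadingDominating s
precedingVertex-∉ isolated-head            = ∉⊥
precedingVertex-∉ (dominating-head latest) = precedingVertex-∉ latest ∘ drop-there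

latestIsolatedVertex≢precedingVertex : ∀ {m} {s : Vec Bool m} (latest : LatestIsolated s) →
                                       latestIsolatedVertex latest ≢ precedingVertex latest
latestIsolatedVertex≢precedingVertex isolated-head            ()
latestIsolatedVertex≢precedingVertex (dominating-head latest) eq =
  latestIsolatedVertex≢precedingVertex latest (suc-injective eq)

latestIsolatedVertex-enclosed : ∀ {m} {s : Vec Bool m} (latest : LatestIsolated s) {w} →
  adj (build s) (latestIsolatedVertex latest) w ≡ true → w ∈ leadingDominating s
latestIsolatedVertex-enclosed isolated-head            {zero}  ()
latestIsolatedVertex-enclosed isolated-head            {suc w} ()
latestIsolatedVertex-enclosed (dominating-head latest) {zero}  _ = here
latestIsolatedVertex-enclosed (dominating-head latest) {suc w} e = there (latestIsolatedVertex-enclosed latest e)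

leadingDominating-cut : ∀ {m} {s : Vec Bool m} → LatestIsolated s → IsVertexCut (build s) (leadingDominating s)
leadingDominating-cut latest =
  latestIsolatedVertex latest , precedingVertex latest , latestIsolatedVertex-∉ latest , precedingVertex-∉ latest ,
  latestIsolatedVertex≢precedingVertex latest ∘ Reach-from-enclosed (latestIsolatedVertex-enclosed latest)

module _ {m} (s : Vec Bool m) where

  Reach-suc : ∀ {b x Y a c} → Reach (build s) Y a c → Reach (build (b ∷ s)) (x ∷ Y) (suc a) (suc c)
  Reach-suc (here a∉)     = here (a∉ ∘ drop-there)
  Reach-suc (step a∉ e r) = step (a∉ ∘ drop-there) e (Reach-suc r)

  -- A path from an old vertex cannot reach the new one if that is removed or isolated.
  Reach-pred : ∀ {b x Y a c} → x ≡ true ⊎ b ≡ false → Reach (build (b ∷ s)) (x ∷ Y) (suc a) c →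
               ∃ λ c′ → c ≡ suc c′ × Reach (build s) Y a c′
  Reach-pred _          (here a∉)                = _ , refl , here (a∉ ∘ there)
  Reach-pred (inj₁ refl) (step {w = zero} _ _ r) = ⊥-elim (Reach-start r here)
  Reach-pred (inj₂ refl) (step {w = zero} _ () _)
  Reach-pred new-gone   (step {w = suc w} a∉ e r) with Reach-pred new-gone r
  ... | c′ , refl , r′ = c′ , refl , step (a∉ ∘ there) e r′

  HasComponents-isolated : ∀ {k} → HasComponents (build s) ∅ k → HasComponents (build (false ∷ s)) ∅ (suc k)
  HasComponents-isolated {k} comps@(f , f-onto , f-exact) = F , F-onto , F-exact
    where
    F : (v : Fin (suc (suc m))) → v ∉ ∅ → Fin (suc k)
    F zero    _  = zero
    F (suc v) v∉ = suc (f v (v∉ ∘ there))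
    F-onto : ∀ c → Σ _ λ v → Σ (v ∉ ∅) λ v∉ → F v v∉ ≡ c
    F-onto zero = zero , ∉⊥ , refl
    F-onto (suc c) with f-onto c
    ... | w , w∉ , fw≡c = suc w , ∉⊥ , cong suc (trans (label-irrelevant comps _ w∉ refl) fw≡c)
    F-exact : ∀ u v (u∉ : u ∉ ∅) (v∉ : v ∉ ∅) → (F u u∉ ≡ F v v∉) ⇔ Reach (build (false ∷ s)) ∅ u v
    F-exact zero    zero    u∉ _  = mk⇔ (λ _ → here u∉) (λ _ → refl)
    F-exact zero    (suc v) _  _  =
      mk⇔ (λ ()) λ r → case Reach-from-enclosed (λ { {zero} () ; {suc _} () }) r of λ ()
    F-exact (suc u) zero    _  _  = mk⇔ (λ ()) λ r → case Reach-pred (inj₂ refl) r of λ { (_ , () , _) }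
    F-exact (suc u) (suc v) _  _  = mk⇔
      (Reach-suc ∘ Equivalence.to (f-exact u v _ _) ∘ suc-injective)
      λ r → case Reach-pred (inj₂ refl) r of λ where
        (_ , refl , r′) → cong suc (Equivalence.from (f-exact u v _ _) r′)

  HasComponents-dominating-removed : ∀ {Y k} → HasComponents (build s) Y k →
                                     HasComponents (build (true ∷ s)) (true ∷ Y) k
  HasComponents-dominating-removed {Y} {k} comps@(f , f-onto , f-exact) = F , F-onto , F-exact
    where
    F : (v : Fin (suc (suc m))) → v ∉ true ∷ Y → Fin k
    F zero    v∉ = ⊥-elim (v∉ here)
    F (suc v) v∉ = f v (v∉ ∘ there)
    F-onto : ∀ c → Σ _ λ v → Σ (v ∉ true ∷ Y) λ v∉ → F v v∉ ≡ c
    F-onto c with f-onto c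
    ... | w , w∉ , fw≡c = suc w , w∉ ∘ drop-there , trans (label-irrelevant comps _ w∉ refl) fw≡c
    F-exact : ∀ u v (u∉ : u ∉ true ∷ Y) (v∉ : v ∉ true ∷ Y) →
              (F u u∉ ≡ F v v∉) ⇔ Reach (build (true ∷ s)) (true ∷ Y) u v
    F-exact zero    _       u∉ _  = ⊥-elim (u∉ here)
    F-exact (suc u) zero    _  v∉ = ⊥-elim (v∉ here)
    F-exact (suc u) (suc v) _  _  = mk⇔
      (Reach-suc ∘ Equivalence.to (f-exact u v _ _))
      λ r → case Reach-pred (inj₁ refl) r of λ { (_ , refl , r′) → Equivalence.from (f-exact u v _ _) r′ }

componentCount : ∀ {m} → Vec Bool m → ℕ
componentCount []          = 1
componentCount (true ∷ _)  = 1
componentCount (false ∷ s) = suc (componentCount s)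

componentsAfterCut : ∀ {m} → Vec Bool m → ℕ
componentsAfterCut (true ∷ s) = componentsAfterCut s
componentsAfterCut s          = componentCount s

HasComponents-build : ∀ {m} (s : Vec Bool m) → HasComponents (build s) ∅ (componentCount s)
HasComponents-build []          =
  universal⇒connected {w = zero} λ { {zero} z≢z → ⊥-elim (z≢z refl) ; {suc ()} }
HasComponents-build (true ∷ s)  =
  universal⇒connected {w = zero} λ { {zero} z≢z → ⊥-elim (z≢z refl) ; {suc _} _ → refl }
HasComponents-build (false ∷ s) = HasComponents-isolated s (HasComponents-build s)

HasComponents-leadingDominating : ∀ {m} (s : Vec Bool m) →
                                  HasComponents (build s) (leadingDominating s) (componentsAfterCut s)
HasComponents-leadingDominating []          = HasComponents-build []
HasComponents-leadingDominating (true ∷ s)  = HasComponents-dominating-removed s (HasComponents-leadingDominating s)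
HasComponents-leadingDominating (false ∷ s) = HasComponents-build (false ∷ s)

bSeq-one : ∀ {m} (s : Vec Bool m) → bSeq s 1 ≡ componentCount s
bSeq-one []          = refl
bSeq-one (true ∷ s)  = refl
bSeq-one (false ∷ s) = cong suc (bSeq-one s)

bSeq-afterLeading : ∀ {m} (s : Vec Bool m) → bSeq s (suc (leadingDominatingSteps s)) ≡ componentsAfterCut s
bSeq-afterLeading []          = refl
bSeq-afterLeading (true ∷ s)  = bSeq-afterLeading s
bSeq-afterLeading (false ∷ s) = cong suc (bSeq-one s)

-- Threshold graphs

module _ {n m} {T : Graph n} (s : Vec Bool m) (I : GraphIso T (build s)) where
  open GraphIso I
  private
    I⁻¹ = GraphIso-sym I
    D   = dominatingSteps s
    U   = pull I (leadingDominating s)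
    K   = pull I (maximumClique s)

    ∣U∣ : ∣ U ∣ ≡ leadingDominatingSteps s
    ∣U∣ = trans (∣pull∣ I (leadingDominating s)) (∣leadingDominating∣ s)

    ∣K∣ : ∣ K ∣ ≡ suc D
    ∣K∣ = trans (∣pull∣ I (maximumClique s)) (∣maximumClique∣ s)

    cliqueCount-T : ∀ i → cliqueCount T i ≡ cliqueSeq s i
    cliqueCount-T i = trans (cliqueCount-pull I i) (cliqueCount-build s i)

    maxCliqueCount-T : ∀ i → maxCliqueCount T i ≡ maximalCliqueSeq s i
    maxCliqueCount-T i = trans (maxCliqueCount-pull I i) (maxCliqueCount-build s i)

  leadingDominating-⊆-cut : ∀ {Y} → IsVertexCut T Y → U ⊆ Y
  leadingDominating-⊆-cut cut v∈U = universal-∈-cut (λ {w} v≢w → trans (adj-to _ w)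
    (leadingDominating-universal s (Equivalence.to (∈-pull⇔ I) v∈U) (v≢w ∘ to-injective))) cut

  vertexConnectivity : LatestIsolated s → ∀ {κ} → IsVertexConnectivity T κ → κ ≡ leadingDominatingSteps s
  vertexConnectivity latest ((Y , cut , ∣Y∣≡κ) , minimal) = ℕₚ.≤-antisym
    (subst (_ ≤_) ∣U∣ (minimal U (IsVertexCut-pull I (leadingDominating-cut latest))))
    (subst₂ _≤_ ∣U∣ ∣Y∣≡κ (p⊆q⇒∣p∣≤∣q∣ (leadingDominating-⊆-cut cut)))

  minimumCut : LatestIsolated s → ∀ {Y} → IsMinimumVertexCut T Y → Y ≡ U
  minimumCut latest (cut , minimal) =
    ≡.sym (⊆∧∣⊇∣⇒≡ (leadingDominating-⊆-cut cut)
                   (minimal U (IsVertexCut-pull I (leadingDominating-cut latest))))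

  minimumCut-components : LatestIsolated s → ∀ {Y} → IsMinimumVertexCut T Y →
                          HasComponents T Y (componentsAfterCut s)
  minimumCut-components latest minY = subst (λ Y → HasComponents T Y _) (≡.sym (minimumCut latest minY))
                                            (HasComponents-pull I (HasComponents-leadingDominating s))

  cliqueNumber : ∀ {d} → IsCliqueNumber T d → d ≡ suc D
  cliqueNumber ((S , isClq , ∣S∣≡d) , bound) = ℕₚ.≤-antisym
    (subst (_≤ suc D) (trans (∣pull∣ I⁻¹ S) ∣S∣≡d)
           (∣clique∣≤ s (Clique-pull I⁻¹ (Equivalence.to (isClique⇔Clique T S) isClq))))
    (subst (_≤ _) ∣K∣ (bound K (Equivalence.from (isClique⇔Clique T K)
                                  (Clique-pull I (proj₁ (maximumClique-maximal s))))))

  -- After the substitution x = y - 1 both sides of the defining identity are polynomials in y,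
  -- and the b-vector is read off as their coefficients.
  bVector : ∀ b → IsBVector T (suc D) b → ∀ i → 1 ≤ i → i ≤ suc D → b i ≡ + bSeq s i
  bVector b isB i 1≤i i≤d = ℤₚ.i-j≡0⇒i≡j (b i) (β i)
    (poly-vanishing⇒coefficients-zero (suc D) (λ i → b i - β i) difference-vanishes i 1≤i i≤d)
    where
    β = λ i → + bSeq s i
    same-poly : ∀ y → poly b (suc D) y ≡ bPoly s y
    same-poly y = begin
      poly b (suc D) y                                    ≡˘⟨ cong (poly b (suc D)) (y-1+1 y) ⟩
      poly b (suc D) (y - + 1 ℤ.+ + 1)                    ≡⟨ isB (y - + 1) ⟩
      poly (λ i → + cliqueCount T i) (suc D) (y - + 1)
        ≡⟨ poly-cong (λ i → + cliqueCount T i) (λ i → + cliqueSeq s i) (suc D) (y - + 1)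
                     (cong +_ ∘ cliqueCount-T ∘ suc) ⟩
      cliquePoly s (y - + 1)                              ≡˘⟨ bPoly-shift s (y - + 1) ⟩
      bPoly s (y - + 1 ℤ.+ + 1)                           ≡⟨ cong (bPoly s) (y-1+1 y) ⟩
      bPoly s y                                           ∎
      where
      open ≡-Reasoning
      y-1+1 : ∀ y → y - + 1 ℤ.+ + 1 ≡ y
      y-1+1 = solve-∀
    difference-vanishes : ∀ y → y ≢ + 0 → poly (λ i → b i - β i) (suc D) y ≡ + 0
    difference-vanishes y _ = begin
      poly (λ i → b i - β i) (suc D) y                      ≡⟨ poly-+ b (λ i → ℤ.- β i) (suc D) y ⟩
      poly b (suc D) y ℤ.+ poly (λ i → ℤ.- β i) (suc D) y   ≡⟨ cong₂ ℤ._+_ (same-poly y) (poly-neg β (suc D) y) ⟩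
      bPoly s y - bPoly s y                                 ≡⟨ ℤₚ.+-inverseʳ (bPoly s y) ⟩
      + 0                                                   ∎
      where open ≡-Reasoning

  minDominating : IsCliqueNumber T (suc D) → ∀ i → 1 ≤ i → i ≤ suc D → IsMinDominating T i (bSeq s i)
  minDominating cn i 1≤i i≤d with i ≟ℕ suc D
  ... | yes refl =
    subst (IsMinDominating T i) (trans (maxCliqueCount-T i) (≡.sym (bSeq-top s))) (minDominating-top T cn)
  minDominating cn (suc j) (s≤s z≤n) i≤d | no i≢d =
    subst (IsMinDominating T (suc j)) (trans (cong suc (maxCliqueCount-T (suc j))) (≡.sym (bSeq-below-top s j i≤D)))
      (minDominating-below T (MaximalClique-pull I (maximumClique-maximal s)) (subst (suc j <_) (≡.sym ∣K∣) (s≤s i≤D))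
                             (Clique-pull I (recentDominating-clique (suc j) s)) ∣core∣ core-⊆)
    where
    i≤D : suc j ≤ D
    i≤D = ℕₚ.≤-pred (ℕₚ.≤∧≢⇒< i≤d i≢d)
    core = pull I (recentDominating (suc j) s)
    ∣core∣ : ∣ core ∣ ≡ suc j
    ∣core∣ = trans (∣pull∣ I (recentDominating (suc j) s)) (∣recentDominating∣ (suc j) s i≤D)
    core-⊆ : ∀ C → MaximalClique T C → suc j < ∣ C ∣ → core ⊆ C
    core-⊆ C max i<∣C∣ = subst (core ⊆_) (pull-pull-sym I C) (⊆-pull I (recentDominating-⊆ (suc j) s
      (MaximalClique-pull I⁻¹ max) (subst (suc j <_) (≡.sym (∣pull∣ I⁻¹ C)) i<∣C∣)))

  module _ (b : ℕ → ℤ) (isB : IsBVector T (suc D) b) where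

    b-leading : ∀ i → 1 ≤ i → i ≤ leadingDominatingSteps s → b i ≡ + 1
    b-leading (suc j) _ i≤κ = trans (bVector b isB (suc j) (s≤s z≤n) (ℕₚ.m≤n⇒m≤1+n i≤D))
      (cong +_ (trans (bSeq-below-top s j i≤D) (cong suc (maximalCliqueSeq-leading s j i≤κ))))
      where
      i≤D : suc j ≤ D
      i≤D = ℕₚ.≤-trans i≤κ (leading≤dominating s)

    b-middle : ∀ i → suc (leadingDominatingSteps s) ≤ i → i ≤ suc D ∸ 1 → b i - + 1 ≡ + maxCliqueCount T i
    b-middle (suc j) _ i≤D = begin
      b (suc j) - + 1                ≡⟨ cong (_- + 1) (bVector b isB (suc j) (s≤s z≤n) (ℕₚ.m≤n⇒m≤1+n i≤D)) ⟩
      + bSeq s (suc j) - + 1         ≡⟨ cong (λ k → + k - + 1) (bSeq-below-top s j i≤D) ⟩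
      + maximalCliqueSeq s (suc j)   ≡˘⟨ cong +_ (maxCliqueCount-T (suc j)) ⟩
      + maxCliqueCount T (suc j)     ∎
      where open ≡-Reasoning

    b-top : b (suc D) ≡ + maxCliqueCount T (suc D)
    b-top = trans (bVector b isB (suc D) (s≤s z≤n) ℕₚ.≤-refl)
                  (cong +_ (trans (bSeq-top s) (≡.sym (maxCliqueCount-T (suc D)))))

    b-components : b (suc (leadingDominatingSteps s)) ≡ + componentsAfterCut s
    b-components = trans (bVector b isB _ (s≤s z≤n) (s≤s (leading≤dominating s))) (cong +_ (bSeq-afterLeading s))

proposition3p3 : ∀ {n} (T : Graph n) (κ d : ℕ) (b : ℕ → ℤ) →
    IsThreshold T → ¬ IsComplete T →
    IsVertexConnectivity T κ → IsCliqueNumber T d → IsBVector T d b →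
    (∀ i → 1 ≤ i → i ≤ κ → b i ≡ + 1) ×
    ((∀ i → suc κ ≤ i → i ≤ d ∸ 1 → b i - + 1 ≡ + maxCliqueCount T i) ×
      b d ≡ + maxCliqueCount T d) ×
    (∀ i → 1 ≤ i → i ≤ d → Σ ℕ λ k → IsMinDominating T i k × b i ≡ + k) ×
    (∀ (Y : Subset n) → IsMinimumVertexCut T Y →
      Σ ℕ λ k → HasComponents T Y k × b (suc κ) ≡ + k)
proposition3p3 T κ d b (m , s , σ , σ-bijective , adj-σ) not-complete conn cn isB
  with bijective⇒GraphIso σ σ-bijective adj-σ | latestIsolated⊎complete s
... | I | inj₂ complete = ⊥-elim (not-complete (IsComplete-iso I complete))
... | I | inj₁ latest with vertexConnectivity s I latest conn | cliqueNumber s I cn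
...   | refl | refl =
  b-leading s I b isB , (b-middle s I b isB , b-top s I b isB) ,
  (λ i 1≤i i≤d → bSeq s i , minDominating s I cn i 1≤i i≤d , bVector s I b isB i 1≤i i≤d) ,
  λ Y minY → componentsAfterCut s , minimumCut-components s I latest minY , b-components s I b isB
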